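{- For each odd prime $p$ and each non-negative integer $k$ there exists a quaternary orthogonal design $\mathrm{COD}\big((1+p^2)p^{2k};\,p^{2k},\,p^{2k+2}\big)$.
   Context: Let $x_1,\dots,x_m$ be commuting real indeterminates. A quaternary orthogonal design $\mathrm{COD}(n;s_1,\dots,s_m)$ of order $n$ and type $(s_1,\dots,s_m)$ is an $n\times n$ matrix $D$ with entries from $\{0\}\cup\{\pm x_\ell,\pm i x_\ell : 1\le \ell\le m\}$ such that $DD^*=\big(\sum_{\ell=1}^m s_\ell x_\ell^2\big) I_n$, where $D^*$ denotes the conjugate transpose. -}

module Defs where

open import Data.Nat using (ℕ; zero; suc)
open import Data.Integer as ℤ using (ℤ; +_)
open import Data.Fin using (Fin)
import Data.Fin as Fin
open import Data.Product using (_×_)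
open import Relation.Binary.PropositionalEquality using (_≡_; _≢_)
open import Relation.Nullary using (Dec; yes; no)
open import Data.Fin using (_≟_)

record ℤi : Set where
  constructor _+i_
  field
    re : ℤ
    im : ℤ
open ℤi public

0ᵢ : ℤi
0ᵢ = (+ 0) +i (+ 0)

_+ᵢ_ : ℤi → ℤi → ℤi
(a +i b) +ᵢ (c +i d) = (a ℤ.+ c) +i (b ℤ.+ d)

_*ᵢ_ : ℤi → ℤi → ℤi
(a +i b) *ᵢ (c +i d) = ((a ℤ.* c) ℤ.- (b ℤ.* d)) +i ((a ℤ.* d) ℤ.+ (b ℤ.* c))

conjᵢ : ℤi → ℤi
conjᵢ (a +i b) = a +i (ℤ.- b)

data Unit4 : Set where
  one minusOne iu minusI : Unit4

unitVal : Unit4 → ℤi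
unitVal one      = (+ 1) +i (+ 0)
unitVal minusOne = (ℤ.- (+ 1)) +i (+ 0)
unitVal iu       = (+ 0) +i (+ 1)
unitVal minusI   = (+ 0) +i (ℤ.- (+ 1))

-- An entry of a quaternary design in variables x_0..x_{m-1}:
-- either 0, or u · x_ℓ with u ∈ {±1, ±i}.
data Entry (m : ℕ) : Set where
  zeroE : Entry m
  varE  : Fin m → Unit4 → Entry m

Matrix : ℕ → ℕ → Set
Matrix m n = Fin n → Fin n → Entry m

-- Homogeneous quadratic polynomial Σ_{ℓ,ℓ'} c ℓ ℓ' · x_ℓ x_ℓ' over ℤ[i]
QPoly : ℕ → Set
QPoly m = Fin m → Fin m → ℤi

-- Equality as polynomials in commuting indeterminates: coefficients of
-- x_ℓ² agree, and coefficients of x_ℓ x_ℓ' (ℓ ≠ ℓ') agree after collecting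
-- both orders.
_≈P_ : ∀ {m} → QPoly m → QPoly m → Set
_≈P_ {m} c d = (ℓ ℓ' : Fin m) →
  (ℓ ≡ ℓ' → c ℓ ℓ ≡ d ℓ ℓ) ×
  (ℓ ≢ ℓ' → (c ℓ ℓ' +ᵢ c ℓ' ℓ) ≡ (d ℓ ℓ' +ᵢ d ℓ' ℓ))

-- coefficient of x_ℓ x_ℓ' in  e · conj(f)
prodCoef : ∀ {m} → Entry m → Entry m → Fin m → Fin m → ℤi
prodCoef zeroE _ _ _ = 0ᵢ
prodCoef (varE _ _) zeroE _ _ = 0ᵢ
prodCoef (varE a u) (varE b v) ℓ ℓ' with a ≟ ℓ | b ≟ ℓ'
... | yes _ | yes _ = unitVal u *ᵢ conjᵢ (unitVal v)
... | _     | _     = 0ᵢ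

sumFin : ∀ n → (Fin n → ℤi) → ℤi
sumFin zero    f = 0ᵢ
sumFin (suc n) f = f Fin.zero +ᵢ sumFin n (λ j → f (Fin.suc j))

DDstar : ∀ {m n} → Matrix m n → Fin n → Fin n → QPoly m
DDstar {m} {n} D a b ℓ ℓ' = sumFin n (λ c → prodCoef (D a c) (D b c) ℓ ℓ')

target : ∀ {m n} → (Fin m → ℕ) → Fin n → Fin n → QPoly m
target s a b ℓ ℓ' with a ≟ b | ℓ ≟ ℓ'
... | yes _ | yes _ = (+ (s ℓ)) +i (+ 0)
... | _     | _     = 0ᵢ

IsCOD : ∀ {m} n → (Fin m → ℕ) → Matrix m n → Set
IsCOD n s D = ∀ a b → DDstar D a b ≈P target s a b

COD : ∀ {m} (n : ℕ) → (Fin m → ℕ) → Set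
COD {m} n s = Σ' (Matrix m n) (IsCOD n s)
  where
  open import Data.Product using () renaming (Σ to Σ')

type2 : ℕ → ℕ → Fin 2 → ℕ
type2 s₁ s₂ Fin.zero = s₁
type2 s₁ s₂ (Fin.suc _) = s₂

{-# OPTIONS --safe #-}
-- The p + 1 parallel classes of lines of the affine plane over ℤ/pℤ give 0/1 matrices A_L of
-- order q = p² with A_L A_Lᵀ = p A_L, A_L A_Mᵀ = J for L ≠ M and Σ_L A_L = J + p I.  As p + 1 is
-- even, Q = Σ_L (-1)^L A_L is symmetric with zero diagonal and ±1 off it, QJ = 0 and QQᵀ = qI - J,
-- so bordering Q with ones gives a symmetric conference matrix C with CCᵀ = qI.  Starting from
-- M = (x₁) and L = (i x₀), the step (M , L) ↦ (Q ⊗ M + I ⊗ L , J ⊗ M) preserves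
--   q MM* + LL* = (s₁ x₀² + s₂ x₁²) I   and   ML* + LM* = 0
-- while multiplying s₁ and s₂ by q.  After k steps, C ⊗ M + I ⊗ L has Gram matrix
-- CCᵀ ⊗ MM* + C ⊗ (ML* + LM*) + I ⊗ LL* = (q^k x₀² + q^(k+1) x₁²) I.
module Submission where

open import Defs

open import Data.Nat as ℕ using (ℕ; zero; suc)
open import Data.Fin using (Fin; zero; suc; _≟_; _↑ˡ_; _↑ʳ_; combine; remQuot)
open import Data.Fin.Properties using (remQuot-combine; combine-remQuot; combine-injective)
open import Data.Product using (_×_; _,_; proj₁; proj₂; ∃)
open import Data.Nat.Primality using (Prime)
open import Function using (_∘_)
open import Data.Bool using (if_then_else_)
open import Relation.Nullary using (does; yes; no; ¬_; contradiction)
open import Relation.Binary.PropositionalEquality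
  using (_≡_; _≢_; refl; sym; trans; cong; cong₂; subst; subst₂; module ≡-Reasoning)
open ≡-Reasoning

module Matrices where

  open import Data.Integer using (ℤ; +_; _+_; _-_; _*_; 0ℤ; 1ℤ)
  open import Data.Integer.Properties
    using (+-*-semiring; suc-*; +-identityˡ; +-identityʳ; +-assoc; *-identityˡ; *-identityʳ; *-zeroˡ; *-zeroʳ;
           *-comm; *-distribʳ-+; *-distribˡ-+)
  open import Data.Integer.Tactic.RingSolver using (solve-∀)
  open import Algebra.Properties.Semiring.Sum +-*-semiring

  ∑-const : ∀ n c → ∑[ i < n ] c ≡ + n * c
  ∑-const zero    c = refl
  ∑-const (suc n) c = trans (cong (_+_ c) (∑-const n c)) (sym (suc-* (+ n) c))

  ∑-↑ : ∀ m {n} (f : Fin (m ℕ.+ n) → ℤ) →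
        ∑[ k < m ℕ.+ n ] f k ≡ ∑[ i < m ] f (i ↑ˡ n) + ∑[ j < n ] f (m ↑ʳ j)
  ∑-↑ zero    f = sym (+-identityˡ _)
  ∑-↑ (suc m) f = trans (cong (_+_ (f zero)) (∑-↑ m (λ k → f (suc k)))) (sym (+-assoc (f zero) _ _))

  ∑-combine : ∀ n {m} (f : Fin (n ℕ.* m) → ℤ) →
              ∑[ k < n ℕ.* m ] f k ≡ ∑[ i < n ] ∑[ a < m ] f (combine i a)
  ∑-combine zero        f = refl
  ∑-combine (suc n) {m} f =
    trans (∑-↑ m f) (cong (_+_ (∑[ a < m ] f (a ↑ˡ n ℕ.* m))) (∑-combine n (λ k → f (m ↑ʳ k))))

  ∑-remQuot : ∀ n {m} (f : Fin n × Fin m → ℤ) →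
              ∑[ k < n ℕ.* m ] f (remQuot m k) ≡ ∑[ i < n ] ∑[ a < m ] f (i , a)
  ∑-remQuot n f = trans (∑-combine n _) (sum-cong-≗ (λ i → sum-cong-≗ (λ a → cong f (remQuot-combine i a))))

  δ : ∀ {n} → Fin n → Fin n → ℤ
  δ i j = if does (i ≟ j) then 1ℤ else 0ℤ

  δ-diagonal : ∀ {n} (i : Fin n) → δ i i ≡ 1ℤ
  δ-diagonal i with i ≟ i
  ... | yes _ = refl
  ... | no i≢i = contradiction refl i≢i

  ∑-δ : ∀ {n} (f : Fin n → ℤ) i → ∑[ k < n ] (f k * δ i k) ≡ f i
  ∑-δ {suc n} f zero = begin
    f zero * 1ℤ + ∑[ k < n ] (f (suc k) * 0ℤ)
      ≡⟨ cong₂ _+_ (*-identityʳ (f zero)) (sum-cong-≗ (λ k → *-zeroʳ (f (suc k)))) ⟩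
    f zero + ∑[ k < n ] 0ℤ                   ≡⟨ cong (_+_ (f zero)) (sum-replicate-zero n) ⟩
    f zero + 0ℤ                              ≡⟨ +-identityʳ _ ⟩
    f zero                                   ∎
  ∑-δ {suc n} f (suc i) = trans (cong₂ _+_ (*-zeroʳ (f zero)) (∑-δ (λ k → f (suc k)) i)) (+-identityˡ _)

  δ-off : ∀ {n} {i j : Fin n} → i ≢ j → δ i j ≡ 0ℤ
  δ-off {i = i} {j} i≢j with i ≟ j
  ... | yes i≡j = contradiction i≡j i≢j
  ... | no _    = refl

  δ-combine : ∀ {n m} (i j : Fin n) (a b : Fin m) → δ (combine i a) (combine j b) ≡ δ i j * δ a b
  δ-combine i j a b with i ≟ j | a ≟ b
  ... | yes refl | yes refl = δ-diagonal (combine i a)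
  ... | no i≢j   | _        = δ-off (i≢j ∘ proj₁ ∘ combine-injective i a j b)
  ... | yes _    | no a≢b   = δ-off (a≢b ∘ proj₂ ∘ combine-injective i a j b)

  ∀-combine : ∀ {n m} {R : Fin (n ℕ.* m) → Fin (n ℕ.* m) → Set} →
              (∀ i a j b → R (combine i a) (combine j b)) → ∀ i′ j′ → R i′ j′
  ∀-combine {n} {m} {R} h i′ j′ =
    subst₂ R (combine-remQuot {n} m i′) (combine-remQuot {n} m j′) (h i a j b)
    where
    i = proj₁ (remQuot {n} m i′)
    a = proj₂ (remQuot {n} m i′)
    j = proj₁ (remQuot {n} m j′)
    b = proj₂ (remQuot {n} m j′)

  Mat : ℕ → Set
  Mat n = Fin n → Fin n → ℤ

  gram : ∀ {n} → Mat n → Mat n → Mat n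
  gram {n} X Y i j = ∑[ k < n ] (X i k * Y j k)

  I J : ∀ {n} → Mat n
  I = δ
  J _ _ = 1ℤ

  _⊕_ : ∀ {n} → Mat n → Mat n → Mat n
  (X ⊕ Y) i j = X i j + Y i j

  flatten : ∀ {n m} {A : Set} → (Fin n × Fin m → Fin n × Fin m → A) → Fin (n ℕ.* m) → Fin (n ℕ.* m) → A
  flatten {n} {m} F i′ j′ = F (remQuot {n} m i′) (remQuot {n} m j′)

  flatten-combine : ∀ {n m} {A : Set} (F : Fin n × Fin m → Fin n × Fin m → A) i a j b →
                    flatten F (combine i a) (combine j b) ≡ F (i , a) (j , b)
  flatten-combine F i a j b = cong₂ F (remQuot-combine i a) (remQuot-combine j b)

  infixr 7 _⊗_
  infixl 6 _⊕_

  _⊗_ : ∀ {n m} → Mat n → Mat m → Mat (n ℕ.* m)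
  P ⊗ X = flatten (λ (i , a) (j , b) → P i j * X a b)

  ⊗-combine : ∀ {n m} (P : Mat n) (X : Mat m) i a j b → (P ⊗ X) (combine i a) (combine j b) ≡ P i j * X a b
  ⊗-combine P X = flatten-combine (λ (i , a) (j , b) → P i j * X a b)

  gram-cong : ∀ {n} {X X′ Y Y′ : Mat n} → (∀ i j → X i j ≡ X′ i j) → (∀ i j → Y i j ≡ Y′ i j) →
              ∀ i j → gram X Y i j ≡ gram X′ Y′ i j
  gram-cong X≗X′ Y≗Y′ i j = sum-cong-≗ (λ k → cong₂ _*_ (X≗X′ i k) (Y≗Y′ j k))

  gram-⊕ˡ : ∀ {n} (X X′ Y : Mat n) i j → gram (X ⊕ X′) Y i j ≡ gram X Y i j + gram X′ Y i j
  gram-⊕ˡ X X′ Y i j =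
    trans (sum-cong-≗ (λ k → *-distribʳ-+ (Y j k) (X i k) (X′ i k)))
          (∑-distrib-+ (λ k → X i k * Y j k) (λ k → X′ i k * Y j k))

  gram-⊕ʳ : ∀ {n} (X Y Y′ : Mat n) i j → gram X (Y ⊕ Y′) i j ≡ gram X Y i j + gram X Y′ i j
  gram-⊕ʳ X Y Y′ i j =
    trans (sum-cong-≗ (λ k → *-distribˡ-+ (X i k) (Y j k) (Y′ j k)))
          (∑-distrib-+ (λ k → X i k * Y j k) (λ k → X i k * Y′ j k))

  gram-⊗ : ∀ {n m} (P P′ : Mat n) (X X′ : Mat m) i a j b →
           gram (P ⊗ X) (P′ ⊗ X′) (combine i a) (combine j b) ≡ gram P P′ i j * gram X X′ a b
  gram-⊗ {n} {m} P P′ X X′ i a j b = begin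
    ∑[ k < n ℕ.* m ] ((P ⊗ X) (combine i a) k * (P′ ⊗ X′) (combine j b) k)
      ≡⟨ ∑-combine n _ ⟩
    ∑[ r < n ] ∑[ c < m ] ((P ⊗ X) (combine i a) (combine r c) * (P′ ⊗ X′) (combine j b) (combine r c))
      ≡⟨ sum-cong-≗ (λ r → sum-cong-≗ (λ c → cong₂ _*_ (⊗-combine P X i a r c) (⊗-combine P′ X′ j b r c))) ⟩
    ∑[ r < n ] ∑[ c < m ] ((P i r * X a c) * (P′ j r * X′ b c))
      ≡⟨ sum-cong-≗ (λ r → sum-cong-≗ (λ c → interchange (P i r) (X a c) (P′ j r) (X′ b c))) ⟩
    ∑[ r < n ] ∑[ c < m ] ((P i r * P′ j r) * (X a c * X′ b c))
      ≡⟨ sum-cong-≗ (λ r → *-distribˡ-sum (P i r * P′ j r) (λ c → X a c * X′ b c)) ⟨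
    ∑[ r < n ] ((P i r * P′ j r) * gram X X′ a b)
      ≡⟨ *-distribʳ-sum (gram X X′ a b) (λ r → P i r * P′ j r) ⟨
    gram P P′ i j * gram X X′ a b ∎
    where
    interchange : ∀ w x y z → (w * x) * (y * z) ≡ (w * y) * (x * z)
    interchange = solve-∀

  gram-Iʳ : ∀ {n} (P : Mat n) i j → gram P I i j ≡ P i j
  gram-Iʳ P i j = ∑-δ (P i) j

  gram-Iˡ : ∀ {n} (P : Mat n) i j → gram I P i j ≡ P j i
  gram-Iˡ P i j = trans (sum-cong-≗ (λ k → *-comm (δ i k) (P j k))) (∑-δ (P j) i)

  gram-Jʳ : ∀ {n} (P : Mat n) i j → gram P J i j ≡ ∑[ k < n ] P i k
  gram-Jʳ P i j = sum-cong-≗ (λ k → *-identityʳ (P i k))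

  gram-Jˡ : ∀ {n} (P : Mat n) i j → gram J P i j ≡ ∑[ k < n ] P j k
  gram-Jˡ P i j = sum-cong-≗ (λ k → *-identityˡ (P j k))

  gram-JJ : ∀ {n} i j → gram {n} J J i j ≡ + n
  gram-JJ {n} i j = trans (∑-const n 1ℤ) (*-identityʳ (+ n))

module Conference where

  open Matrices
  open import Data.Integer using (+_; _+_; _-_; _*_; 0ℤ; 1ℤ; -1ℤ)
  open import Data.Integer.Properties using (+-*-semiring; +-identityˡ; *-zeroʳ)
  open import Data.Integer.Tactic.RingSolver using (solve-∀)
  open import Algebra.Properties.Semiring.Sum +-*-semiring
  open import Data.Sum using (_⊎_; inj₁)

  record IsSeidel {n} (S : Mat n) : Set where
    field
      hollow    : ∀ i → S i i ≡ 0ℤ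
      signed    : ∀ i j → i ≢ j → S i j ≡ 1ℤ ⊎ S i j ≡ -1ℤ
      symmetric : ∀ i j → S i j ≡ S j i

  record IsCore (q : ℕ) (Q : Mat q) : Set where
    field
      seidel    : IsSeidel Q
      row-sum   : ∀ i → ∑[ j < q ] Q i j ≡ 0ℤ
      gram-self : ∀ i j → gram Q Q i j ≡ + q * δ i j - 1ℤ

  record IsSymmetricConference (q : ℕ) (C : Mat (suc q)) : Set where
    field
      seidel    : IsSeidel C
      gram-self : ∀ i j → gram C C i j ≡ + q * δ i j

  border : ∀ {q} → Mat q → Mat (suc q)
  border Q zero    zero    = 0ℤ
  border Q zero    (suc j) = 1ℤ
  border Q (suc i) zero    = 1ℤ
  border Q (suc i) (suc j) = Q i j

  module _ {q} {Q : Mat q} (core : IsCore q Q) where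

    open IsCore core using (row-sum; gram-self)
    open IsSeidel (IsCore.seidel core)

    border-seidel : IsSeidel (border Q)
    border-seidel = record { hollow = hollow′ ; signed = signed′ ; symmetric = symmetric′ }
      where
      hollow′ : ∀ i → border Q i i ≡ 0ℤ
      hollow′ zero    = refl
      hollow′ (suc i) = hollow i
      signed′ : ∀ i j → i ≢ j → border Q i j ≡ 1ℤ ⊎ border Q i j ≡ -1ℤ
      signed′ zero    zero    0≢0 = contradiction refl 0≢0
      signed′ zero    (suc j) _   = inj₁ refl
      signed′ (suc i) zero    _   = inj₁ refl
      signed′ (suc i) (suc j) i≢j = signed i j (i≢j ∘ cong suc)
      symmetric′ : ∀ i j → border Q i j ≡ border Q j i
      symmetric′ zero    zero    = refl
      symmetric′ zero    (suc j) = refl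
      symmetric′ (suc i) zero    = refl
      symmetric′ (suc i) (suc j) = symmetric i j

    gram-border : ∀ i j → gram (border Q) (border Q) i j ≡ + q * δ i j
    gram-border zero    zero    = trans (+-identityˡ _) (∑-const q 1ℤ)
    gram-border zero    (suc j) = begin
      0ℤ + ∑[ k < q ] (1ℤ * Q j k) ≡⟨ +-identityˡ _ ⟩
      gram J Q j j                 ≡⟨ trans (gram-Jˡ Q j j) (row-sum j) ⟩
      0ℤ                           ≡⟨ *-zeroʳ (+ q) ⟨
      + q * 0ℤ                     ∎
    gram-border (suc i) zero    = begin
      0ℤ + ∑[ k < q ] (Q i k * 1ℤ) ≡⟨ +-identityˡ _ ⟩
      gram Q J i i                 ≡⟨ trans (gram-Jʳ Q i i) (row-sum i) ⟩
      0ℤ                           ≡⟨ *-zeroʳ (+ q) ⟨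
      + q * 0ℤ                     ∎
    gram-border (suc i) (suc j) = trans (cong (_+_ 1ℤ) (gram-self i j)) (1+[x-1]≡x (+ q * δ i j))
      where
      1+[x-1]≡x : ∀ x → 1ℤ + (x - 1ℤ) ≡ x
      1+[x-1]≡x = solve-∀

    border-conference : IsSymmetricConference q (border Q)
    border-conference = record { seidel = border-seidel ; gram-self = gram-border }

module ParallelClassCore where

  open Matrices
  open Conference
  open import Data.Integer using (ℤ; +_; -_; _+_; _-_; _*_; 0ℤ; 1ℤ; -1ℤ)
  open import Data.Integer.Properties
    using (+-*-semiring; +-identityʳ; *-identityˡ; *-identityʳ; *-zeroˡ; *-zeroʳ; pos-*)
  open import Data.Integer.Tactic.RingSolver using (solve-∀)
  open import Algebra.Properties.Semiring.Sum +-*-semiring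
  open import Data.Sum using (_⊎_; inj₁; inj₂)
  open import Data.Fin using (toℕ)
  open import Data.Nat.Divisibility using (_∣_; divides)

  -- A L u v is 1 if the points u and v lie on a common line of the L-th parallel class of an
  -- affine plane of order r, and 0 otherwise.
  record ParallelClasses (r : ℕ) (A : Fin (suc r) → Mat (r ℕ.* r)) : Set where
    field
      reflexive     : ∀ L u → A L u u ≡ 1ℤ
      symmetric     : ∀ L u v → A L u v ≡ A L v u
      line-size     : ∀ L u → ∑[ v < r ℕ.* r ] A L u v ≡ + r
      gram-parallel : ∀ L u v → gram (A L) (A L) u v ≡ + r * A L u v
      gram-crossing : ∀ L M → L ≢ M → ∀ u v → gram (A L) (A M) u v ≡ 1ℤ
      unique-class  : ∀ u v → u ≢ v → ∃ λ L → ∀ M → A M u v ≡ δ L M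

  record Balanced {n} (ε : Fin n → ℤ) : Set where
    field
      unit     : ∀ i → ε i ≡ 1ℤ ⊎ ε i ≡ -1ℤ
      sum-zero : ∑[ i < n ] ε i ≡ 0ℤ

  alternating : ℕ → ℤ
  alternating zero          = 1ℤ
  alternating (suc zero)    = -1ℤ
  alternating (suc (suc n)) = alternating n

  balanced-alternating : ∀ h → Balanced {h ℕ.* 2} (alternating ∘ toℕ)
  balanced-alternating h = record { unit = unit ∘ toℕ ; sum-zero = sum-zero h }
    where
    unit : ∀ n → alternating n ≡ 1ℤ ⊎ alternating n ≡ -1ℤ
    unit zero          = inj₁ refl
    unit (suc zero)    = inj₂ refl
    unit (suc (suc n)) = unit n
    sum-zero : ∀ h → ∑[ i < h ℕ.* 2 ] alternating (toℕ i) ≡ 0ℤ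
    sum-zero zero    = refl
    sum-zero (suc h) = trans (1+[-1+x]≡x _) (sum-zero h)
      where
      1+[-1+x]≡x : ∀ x → 1ℤ + (-1ℤ + x) ≡ x
      1+[-1+x]≡x = solve-∀

  even-or-odd : ∀ n → 2 ∣ n ⊎ 2 ∣ suc n
  even-or-odd zero    = inj₁ (divides 0 refl)
  even-or-odd (suc n) with even-or-odd n
  ... | inj₁ (divides h n≡2h) = inj₂ (divides (suc h) (cong (2 ℕ.+_) n≡2h))
  ... | inj₂ 2∣1+n            = inj₁ 2∣1+n

  balanced-of-odd : ∀ {r} → ¬ 2 ∣ r → Balanced {suc r} (alternating ∘ toℕ)
  balanced-of-odd {r} r-odd with even-or-odd r
  ... | inj₁ 2∣r                 = contradiction 2∣r r-odd
  ... | inj₂ (divides h 1+r≡2h) =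
    subst (λ n → Balanced {n} (alternating ∘ toℕ)) (sym 1+r≡2h) (balanced-alternating h)

  signedSum : ∀ {c n} → (Fin c → ℤ) → (Fin c → Mat n) → Mat n
  signedSum {c} ε A u v = ∑[ L < c ] (ε L * A L u v)

  gram-signedSum : ∀ {c d n} (ε : Fin c → ℤ) (A : Fin c → Mat n) (η : Fin d → ℤ) (B : Fin d → Mat n) u v →
    gram (signedSum ε A) (signedSum η B) u v ≡ ∑[ L < c ] ∑[ M < d ] (ε L * η M * gram (A L) (B M) u v)
  gram-signedSum {c} {d} {n} ε A η B u v = begin
    ∑[ w < n ] (∑[ L < c ] (ε L * A L u w) * ∑[ M < d ] (η M * B M v w))
      ≡⟨ sum-cong-≗ (λ w → *-distribʳ-sum (∑[ M < d ] (η M * B M v w)) (λ L → ε L * A L u w)) ⟩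
    ∑[ w < n ] ∑[ L < c ] (ε L * A L u w * ∑[ M < d ] (η M * B M v w))
      ≡⟨ sum-cong-≗ (λ w → sum-cong-≗ (λ L → *-distribˡ-sum (ε L * A L u w) (λ M → η M * B M v w))) ⟩
    ∑[ w < n ] ∑[ L < c ] ∑[ M < d ] (ε L * A L u w * (η M * B M v w))
      ≡⟨ ∑-comm (λ w L → ∑[ M < d ] (ε L * A L u w * (η M * B M v w))) ⟩
    ∑[ L < c ] ∑[ w < n ] ∑[ M < d ] (ε L * A L u w * (η M * B M v w))
      ≡⟨ sum-cong-≗ (λ L → ∑-comm (λ w M → ε L * A L u w * (η M * B M v w))) ⟩
    ∑[ L < c ] ∑[ M < d ] ∑[ w < n ] (ε L * A L u w * (η M * B M v w))
      ≡⟨ sum-cong-≗ (λ L → sum-cong-≗ (λ M → sum-cong-≗ (λ w → interchange (ε L) (A L u w) (η M) (B M v w)))) ⟩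
    ∑[ L < c ] ∑[ M < d ] ∑[ w < n ] (ε L * η M * (A L u w * B M v w))
      ≡⟨ sum-cong-≗ (λ L → sum-cong-≗ (λ M → *-distribˡ-sum (ε L * η M) (λ w → A L u w * B M v w))) ⟨
    ∑[ L < c ] ∑[ M < d ] (ε L * η M * gram (A L) (B M) u v) ∎
    where
    interchange : ∀ w x y z → w * x * (y * z) ≡ w * y * (x * z)
    interchange = solve-∀

  module _ {r} {A : Fin (suc r) → Mat (r ℕ.* r)} (classes : ParallelClasses r A)
           {ε : Fin (suc r) → ℤ} (balanced : Balanced ε) where

    open ParallelClasses classes
    open Balanced balanced

    private
      ε²≡1 : ∀ L → ε L * ε L ≡ 1ℤ
      ε²≡1 L with unit L
      ... | inj₁ εL≡1  rewrite εL≡1  = refl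
      ... | inj₂ εL≡-1 rewrite εL≡-1 = refl

      lines-through : ∀ u v → ∑[ L < suc r ] A L u v ≡ 1ℤ + + r * δ u v
      lines-through u v with u ≟ v
      ... | yes refl = begin
        ∑[ L < suc r ] A L u u  ≡⟨ sum-cong-≗ (λ L → reflexive L u) ⟩
        ∑[ L < suc r ] 1ℤ       ≡⟨ trans (∑-const (suc r) 1ℤ) (*-identityʳ (+ suc r)) ⟩
        1ℤ + + r                ≡⟨ cong (_+_ 1ℤ) (*-identityʳ (+ r)) ⟨
        1ℤ + + r * 1ℤ           ∎
      ... | no u≢v with unique-class u v u≢v
      ...   | L , A≡δ = begin
        ∑[ M < suc r ] A M u v          ≡⟨ sum-cong-≗ (λ M → trans (A≡δ M) (sym (*-identityˡ (δ L M)))) ⟩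
        ∑[ M < suc r ] (1ℤ * δ L M)     ≡⟨ ∑-δ (λ _ → 1ℤ) L ⟩
        1ℤ                              ≡⟨ +-identityʳ 1ℤ ⟨
        1ℤ + 0ℤ                         ≡⟨ cong (_+_ 1ℤ) (*-zeroʳ (+ r)) ⟨
        1ℤ + + r * 0ℤ                   ∎

      gram-classes : ∀ L M u v → gram (A L) (A M) u v ≡ 1ℤ + δ L M * (+ r * A L u v - 1ℤ)
      gram-classes L M u v with L ≟ M
      ... | yes refl = begin
        gram (A L) (A L) u v                  ≡⟨ gram-parallel L u v ⟩
        + r * A L u v                         ≡⟨ 1+1*[x-1]≡x (+ r * A L u v) ⟨
        1ℤ + 1ℤ * (+ r * A L u v - 1ℤ)        ∎
        where
        1+1*[x-1]≡x : ∀ x → 1ℤ + 1ℤ * (x - 1ℤ) ≡ x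
        1+1*[x-1]≡x = solve-∀
      ... | no L≢M = begin
        gram (A L) (A M) u v                  ≡⟨ gram-crossing L M L≢M u v ⟩
        1ℤ                                    ≡⟨ +-identityʳ 1ℤ ⟨
        1ℤ + 0ℤ                               ≡⟨ cong (_+_ 1ℤ) (*-zeroˡ (+ r * A L u v - 1ℤ)) ⟨
        1ℤ + 0ℤ * (+ r * A L u v - 1ℤ)        ∎

      signs-cancel : ∀ L x → ∑[ M < suc r ] (ε L * ε M * (1ℤ + δ L M * x)) ≡ x
      signs-cancel L x = begin
        ∑[ M < suc r ] (ε L * ε M * (1ℤ + δ L M * x))
          ≡⟨ sum-cong-≗ (λ M → expand (ε L) (ε M) (δ L M) x) ⟩
        ∑[ M < suc r ] (ε L * ε M + ε L * x * (ε M * δ L M))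
          ≡⟨ ∑-distrib-+ (λ M → ε L * ε M) (λ M → ε L * x * (ε M * δ L M)) ⟩
        ∑[ M < suc r ] (ε L * ε M) + ∑[ M < suc r ] (ε L * x * (ε M * δ L M))
          ≡⟨ cong₂ _+_ (*-distribˡ-sum (ε L) ε) (*-distribˡ-sum (ε L * x) (λ M → ε M * δ L M)) ⟨
        ε L * ∑[ M < suc r ] ε M + ε L * x * ∑[ M < suc r ] (ε M * δ L M)
          ≡⟨ cong₂ (λ s t → ε L * s + ε L * x * t) sum-zero (∑-δ ε L) ⟩
        ε L * 0ℤ + ε L * x * ε L
          ≡⟨ regroup (ε L) x ⟩
        ε L * ε L * x
          ≡⟨ trans (cong (_* x) (ε²≡1 L)) (*-identityˡ x) ⟩
        x ∎
        where
        expand : ∀ a b d x → a * b * (1ℤ + d * x) ≡ a * b + a * x * (b * d)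
        expand = solve-∀
        regroup : ∀ e x → e * 0ℤ + e * x * e ≡ e * e * x
        regroup = solve-∀

    signedSum-hollow : ∀ u → signedSum ε A u u ≡ 0ℤ
    signedSum-hollow u = trans (sum-cong-≗ (λ L → trans (cong (ε L *_) (reflexive L u)) (*-identityʳ (ε L)))) sum-zero

    signedSum-signed : ∀ u v → u ≢ v → signedSum ε A u v ≡ 1ℤ ⊎ signedSum ε A u v ≡ -1ℤ
    signedSum-signed u v u≢v with unique-class u v u≢v
    ... | L , A≡δ = subst (λ z → z ≡ 1ℤ ⊎ z ≡ -1ℤ) (sym Q≡εL) (unit L)
      where
      Q≡εL : signedSum ε A u v ≡ ε L
      Q≡εL = trans (sum-cong-≗ (λ M → cong (ε M *_) (A≡δ M))) (∑-δ ε L)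

    signedSum-symmetric : ∀ u v → signedSum ε A u v ≡ signedSum ε A v u
    signedSum-symmetric u v = sum-cong-≗ (λ L → cong (ε L *_) (symmetric L u v))

    signedSum-row-sum : ∀ u → ∑[ v < r ℕ.* r ] signedSum ε A u v ≡ 0ℤ
    signedSum-row-sum u = begin
      ∑[ v < r ℕ.* r ] ∑[ L < suc r ] (ε L * A L u v)   ≡⟨ ∑-comm (λ v L → ε L * A L u v) ⟩
      ∑[ L < suc r ] ∑[ v < r ℕ.* r ] (ε L * A L u v)   ≡⟨ sum-cong-≗ (λ L → *-distribˡ-sum (ε L) (A L u)) ⟨
      ∑[ L < suc r ] (ε L * ∑[ v < r ℕ.* r ] A L u v)   ≡⟨ sum-cong-≗ (λ L → cong (ε L *_) (line-size L u)) ⟩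
      ∑[ L < suc r ] (ε L * + r)                        ≡⟨ *-distribʳ-sum (+ r) ε ⟨
      ∑[ L < suc r ] ε L * + r                          ≡⟨ cong (_* + r) sum-zero ⟩
      0ℤ * + r                                          ≡⟨ *-zeroˡ (+ r) ⟩
      0ℤ                                                ∎

    signedSum-gram : ∀ u v → gram (signedSum ε A) (signedSum ε A) u v ≡ + (r ℕ.* r) * δ u v - 1ℤ
    signedSum-gram u v = begin
      gram (signedSum ε A) (signedSum ε A) u v
        ≡⟨ gram-signedSum ε A ε A u v ⟩
      ∑[ L < suc r ] ∑[ M < suc r ] (ε L * ε M * gram (A L) (A M) u v)
        ≡⟨ sum-cong-≗ (λ L → sum-cong-≗ (λ M → cong (ε L * ε M *_) (gram-classes L M u v))) ⟩
      ∑[ L < suc r ] ∑[ M < suc r ] (ε L * ε M * (1ℤ + δ L M * (+ r * A L u v - 1ℤ)))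
        ≡⟨ sum-cong-≗ (λ L → signs-cancel L (+ r * A L u v - 1ℤ)) ⟩
      ∑[ L < suc r ] (+ r * A L u v - 1ℤ)
        ≡⟨ ∑-distrib-+ (λ L → + r * A L u v) (λ _ → -1ℤ) ⟩
      ∑[ L < suc r ] (+ r * A L u v) + ∑[ L < suc r ] -1ℤ
        ≡⟨ cong₂ _+_ (*-distribˡ-sum (+ r) (λ L → A L u v)) (sym (∑-const (suc r) -1ℤ)) ⟨
      + r * ∑[ L < suc r ] A L u v + + suc r * -1ℤ
        ≡⟨ cong (λ s → + r * s + + suc r * -1ℤ) (lines-through u v) ⟩
      + r * (1ℤ + + r * δ u v) + (1ℤ + + r) * -1ℤ
        ≡⟨ simplify (+ r) (δ u v) ⟩
      + r * + r * δ u v - 1ℤ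
        ≡⟨ cong (λ s → s * δ u v - 1ℤ) (pos-* r r) ⟨
      + (r ℕ.* r) * δ u v - 1ℤ ∎
      where
      simplify : ∀ r d → r * (1ℤ + r * d) + (1ℤ + r) * -1ℤ ≡ r * r * d - 1ℤ
      simplify = solve-∀

    signedSum-core : IsCore (r ℕ.* r) (signedSum ε A)
    signedSum-core = record
      { seidel    = record { hollow = signedSum-hollow ; signed = signedSum-signed ; symmetric = signedSum-symmetric }
      ; row-sum   = signedSum-row-sum
      ; gram-self = signedSum-gram
      }

module Residues (p : ℕ) (p-prime : Prime p) where

  open Matrices
  open import Data.Integer using (ℤ; +_; -_; _+_; _-_; _*_; 0ℤ; 1ℤ; ∣_∣; -[1+_]; _%ℕ_; _/ℕ_)
  open import Data.Integer.Properties
    using (+-*-semiring; pos-*; *-comm; *-identityˡ; abs-*; +-inverseʳ; +-injective; i-j≡0⇒i≡j;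
           ∣i∣≡0⇒i≡0; ∣m⊝n∣≤m⊔n; [+m]-[+n]≡m⊖n)
  open import Data.Integer.DivMod using (a≡a%ℕn+[a/ℕn]*n; n%ℕd<d)
  open import Data.Integer.Divisibility.Signed
    using (_∣_; divides; ∣m⇒∣-m; ∣m∣n⇒∣m+n; ∣m∣n⇒∣m-n; ∣n⇒∣m*n; ∣⇒∣ᵤ; ∣ᵤ⇒∣)
  open import Data.Integer.Tactic.RingSolver using (solve-∀)
  open import Algebra.Properties.Semiring.Sum +-*-semiring
  import Data.Nat.Properties as ℕ
  import Data.Nat.Divisibility as ℕ
  open import Data.Nat.Coprimality using (Coprime; coprime-Bézout)
  open import Data.Nat.GCD using (module Bézout)
  open import Data.Nat.Primality using (prime⇒nonZero; prime⇒nonTrivial; prime⇒irreducible; euclidsLemma)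
  open import Data.Fin using (toℕ; fromℕ<)
  open import Data.Fin.Properties using (toℕ-injective; toℕ<n; toℕ-fromℕ<)
  open import Data.Sum as Sum using (_⊎_; inj₁; inj₂)

  private instance
    p≢0 : ℕ.NonZero p
    p≢0 = prime⇒nonZero p-prime

  -- Decided on ∣ z ∣ in ℕ: the signed decision procedure normalises to this one, so proofs
  -- case-split on p ℕ.∣? ∣ z ∣ with 'with'.
  [p∣_] : ℤ → ℤ
  [p∣ z ] = if does (p ℕ.∣? ∣ z ∣) then 1ℤ else 0ℤ

  infix 4 [_≡_]

  [_≡_] : ℤ → ℤ → ℤ
  [ a ≡ b ] = [p∣ a - b ]

  [p∣]-true : ∀ {z} → + p ∣ z → [p∣ z ] ≡ 1ℤ
  [p∣]-true {z} p∣z with p ℕ.∣? ∣ z ∣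
  ... | yes _  = refl
  ... | no p∤z = contradiction (∣⇒∣ᵤ p∣z) p∤z

  [p∣]-false : ∀ {z} → ¬ + p ∣ z → [p∣ z ] ≡ 0ℤ
  [p∣]-false {z} p∤z with p ℕ.∣? ∣ z ∣
  ... | yes p∣z = contradiction (∣ᵤ⇒∣ p∣z) p∤z
  ... | no _    = refl

  [p∣]-resp : ∀ {z w} → (+ p ∣ z → + p ∣ w) → (+ p ∣ w → + p ∣ z) → [p∣ z ] ≡ [p∣ w ]
  [p∣]-resp {z} {w} ⇒ ⇐ with p ℕ.∣? ∣ z ∣ | p ℕ.∣? ∣ w ∣
  ... | yes _   | yes _   = refl
  ... | no _    | no _    = refl
  ... | yes p∣z | no p∤w  = contradiction (∣⇒∣ᵤ (⇒ (∣ᵤ⇒∣ p∣z))) p∤w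
  ... | no p∤z  | yes p∣w = contradiction (∣⇒∣ᵤ (⇐ (∣ᵤ⇒∣ p∣w))) p∤z

  [≡]-refl : ∀ a → [ a ≡ a ] ≡ 1ℤ
  [≡]-refl a = [p∣]-true (divides 0ℤ (+-inverseʳ a))

  [≡]-sym : ∀ a b → [ a ≡ b ] ≡ [ b ≡ a ]
  [≡]-sym a b = [p∣]-resp (λ p∣a-b → subst (+ p ∣_) (negate a b) (∣m⇒∣-m p∣a-b))
                          (λ p∣b-a → subst (+ p ∣_) (negate b a) (∣m⇒∣-m p∣b-a))
    where
    negate : ∀ a b → - (a - b) ≡ b - a
    negate = solve-∀

  [≡]-transport : ∀ a a′ b → + p ∣ a - a′ → [ a ≡ b ] ≡ [ a′ ≡ b ]
  [≡]-transport a a′ b p∣a-a′ =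
    [p∣]-resp (λ p∣a-b → subst (+ p ∣_) (shift₁ a a′ b) (∣m∣n⇒∣m-n p∣a-b p∣a-a′))
              (λ p∣a′-b → subst (+ p ∣_) (shift₂ a a′ b) (∣m∣n⇒∣m+n p∣a′-b p∣a-a′))
    where
    shift₁ : ∀ a a′ b → a - b - (a - a′) ≡ a′ - b
    shift₁ = solve-∀
    shift₂ : ∀ a a′ b → a′ - b + (a - a′) ≡ a - b
    shift₂ = solve-∀

  ι : Fin p → ℤ
  ι x = + toℕ x

  ι-injective : ∀ {x y} → + p ∣ ι x - ι y → x ≡ y
  ι-injective {x} {y} p∣x-y =
    toℕ-injective (+-injective (i-j≡0⇒i≡j (ι x) (ι y)
      (∣i∣≡0⇒i≡0 (multiple-below (∣⇒∣ᵤ p∣x-y) bound))))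
    where
    multiple-below : ∀ {n} → p ℕ.∣ n → n ℕ.< p → n ≡ 0
    multiple-below (ℕ.divides zero    n≡0)  _   = n≡0
    multiple-below (ℕ.divides (suc q) refl) n<p = contradiction n<p (ℕ.≤⇒≯ (ℕ.m≤m+n p (q ℕ.* p)))
    bound : ∣ ι x - ι y ∣ ℕ.< p
    bound = subst (ℕ._< p) (cong ∣_∣ (sym ([+m]-[+n]≡m⊖n (toℕ x) (toℕ y))))
                  (ℕ.≤-<-trans (∣m⊝n∣≤m⊔n (toℕ x) (toℕ y)) (ℕ.⊔-pres-<m (toℕ<n x) (toℕ<n y)))

  residue : ∀ z → ∃ λ (x : Fin p) → + p ∣ ι x - z
  residue z = x , divides (- (z /ℕ p)) (begin
    ι x - z
      ≡⟨ cong₂ _-_ (cong +_ (toℕ-fromℕ< (n%ℕd<d z p))) (a≡a%ℕn+[a/ℕn]*n z p) ⟩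
    + (z %ℕ p) - (+ (z %ℕ p) + z /ℕ p * + p)
      ≡⟨ cancel (+ (z %ℕ p)) (z /ℕ p) (+ p) ⟩
    - (z /ℕ p) * + p ∎)
    where
    x = fromℕ< (n%ℕd<d z p)
    cancel : ∀ r q p → r - (r + q * p) ≡ - q * p
    cancel = solve-∀

  euclid : ∀ a b → + p ∣ a * b → (+ p ∣ a) ⊎ (+ p ∣ b)
  euclid a b p∣ab =
    Sum.map ∣ᵤ⇒∣ ∣ᵤ⇒∣
      (euclidsLemma ∣ a ∣ ∣ b ∣ p-prime (subst (p ℕ.∣_) (abs-* a b) (∣⇒∣ᵤ p∣ab)))

  inverse : ∀ d → ¬ + p ∣ d → ∃ λ e → + p ∣ d * e - 1ℤ
  inverse (+ n)    p∤d = inverse-ℕ n (p∤d ∘ ∣ᵤ⇒∣)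
    where
    coprime : ∀ n → ¬ p ℕ.∣ n → Coprime n p
    coprime n p∤n (k∣n , k∣p) with prime⇒irreducible p-prime k∣p
    ... | inj₁ k≡1 = k≡1
    ... | inj₂ refl = contradiction k∣n p∤n
    inverse-ℕ : ∀ n → ¬ p ℕ.∣ n → ∃ λ e → + p ∣ + n * e - 1ℤ
    inverse-ℕ n p∤n with coprime-Bézout (coprime n p∤n)
    ... | Bézout.+- x y 1+yp≡xn = + x , divides (+ y) (begin
      + n * + x - 1ℤ          ≡⟨ cong (_- 1ℤ) (trans (*-comm (+ n) (+ x)) (sym (pos-* x n))) ⟩
      + (x ℕ.* n) - 1ℤ        ≡⟨ cong (λ z → + z - 1ℤ) 1+yp≡xn ⟨
      + (1 ℕ.+ y ℕ.* p) - 1ℤ  ≡⟨ cong (λ z → 1ℤ + z - 1ℤ) (pos-* y p) ⟩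
      1ℤ + + y * + p - 1ℤ     ≡⟨ cancel (+ y * + p) ⟩
      + y * + p               ∎)
      where
      cancel : ∀ z → 1ℤ + z - 1ℤ ≡ z
      cancel = solve-∀
    ... | Bézout.-+ x y 1+xn≡yp = - + x , divides (- + y) (begin
      + n * - + x - 1ℤ        ≡⟨ rearrange (+ n) (+ x) ⟩
      - (1ℤ + + x * + n)      ≡⟨ cong (λ z → - (1ℤ + z)) (pos-* x n) ⟨
      - + (1 ℕ.+ x ℕ.* n)     ≡⟨ cong (λ z → - + z) 1+xn≡yp ⟩
      - + (y ℕ.* p)           ≡⟨ cong -_ (pos-* y p) ⟩
      - (+ y * + p)           ≡⟨ neg-* (+ y) (+ p) ⟩
      - + y * + p             ∎)
      where
      rearrange : ∀ n x → n * - x - 1ℤ ≡ - (1ℤ + x * n)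
      rearrange = solve-∀
      neg-* : ∀ y p → - (y * p) ≡ - y * p
      neg-* = solve-∀
  inverse -[1+ n ] p∤d with inverse (+ suc n) (p∤d ∘ ∣ᵤ⇒∣ ∘ ∣⇒∣ᵤ)
  ... | e , p∣ne-1 = - e , subst (+ p ∣_) (negate-both (+ suc n) e) p∣ne-1
    where
    negate-both : ∀ n e → n * e - 1ℤ ≡ - n * - e - 1ℤ
    negate-both = solve-∀

  solution : ∀ d c → ¬ + p ∣ d → ∃ λ x → + p ∣ d * ι x - c
  solution d c p∤d with inverse d p∤d
  ... | e , p∣de-1 with residue (c * e)
  ...   | x , p∣x-ce =
    x , subst (+ p ∣_) (regroup d (ι x) c e) (∣m∣n⇒∣m+n (∣n⇒∣m*n d p∣x-ce) (∣n⇒∣m*n c p∣de-1))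
    where
    regroup : ∀ d x c e → d * (x - c * e) + c * (d * e - 1ℤ) ≡ d * x - c
    regroup = solve-∀

  solution-unique : ∀ {d c x₀} → ¬ + p ∣ d → + p ∣ d * ι x₀ - c → ∀ x → [ d * ι x ≡ c ] ≡ δ x₀ x
  solution-unique {d} {c} {x₀} p∤d p∣dx₀-c x with x₀ ≟ x
  ... | yes refl = [p∣]-true p∣dx₀-c
  ... | no x₀≢x  = [p∣]-false (x₀≢x ∘ root-equal)
    where
    difference : ∀ d x y c → d * x - c - (d * y - c) ≡ d * (x - y)
    difference = solve-∀
    root-equal : + p ∣ d * ι x - c → x₀ ≡ x
    root-equal p∣dx-c
      with euclid d (ι x₀ - ι x) (subst (+ p ∣_) (difference d (ι x₀) (ι x) c) (∣m∣n⇒∣m-n p∣dx₀-c p∣dx-c))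
    ... | inj₁ p∣d    = contradiction p∣d p∤d
    ... | inj₂ p∣x₀-x = ι-injective p∣x₀-x

  count-solutions : ∀ d c → ¬ + p ∣ d → ∑[ x < p ] [ d * ι x ≡ c ] ≡ 1ℤ
  count-solutions d c p∤d with solution d c p∤d
  ... | x₀ , p∣dx₀-c = begin
    ∑[ x < p ] [ d * ι x ≡ c ]
      ≡⟨ sum-cong-≗ (λ x → trans (solution-unique p∤d p∣dx₀-c x) (sym (*-identityˡ (δ x₀ x)))) ⟩
    ∑[ x < p ] (1ℤ * δ x₀ x)     ≡⟨ ∑-δ (λ _ → 1ℤ) x₀ ⟩
    1ℤ                           ∎

  count-residues : ∀ c → ∑[ x < p ] [ ι x ≡ c ] ≡ 1ℤ
  count-residues c =
    trans (sum-cong-≗ (λ x → cong [p∣_] (cong (_- c) (sym (*-identityˡ (ι x)))))) (count-solutions 1ℤ c p∤1)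
    where
    p∤1 : ¬ + p ∣ 1ℤ
    p∤1 p∣1 with ℕ.∣1⇒≡1 (∣⇒∣ᵤ p∣1) | prime⇒nonTrivial p-prime
    ... | refl | ()

  count-common : ∀ a b → ∑[ x < p ] ([ ι x ≡ a ] * [ ι x ≡ b ]) ≡ [ a ≡ b ]
  count-common a b = begin
    ∑[ x < p ] ([ ι x ≡ a ] * [ ι x ≡ b ])   ≡⟨ sum-cong-≗ (λ x → collapse (ι x)) ⟩
    ∑[ x < p ] ([ ι x ≡ a ] * [ a ≡ b ])     ≡⟨ *-distribʳ-sum [ a ≡ b ] (λ x → [ ι x ≡ a ]) ⟨
    ∑[ x < p ] [ ι x ≡ a ] * [ a ≡ b ]       ≡⟨ cong (_* [ a ≡ b ]) (count-residues a) ⟩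
    1ℤ * [ a ≡ b ]                           ≡⟨ *-identityˡ [ a ≡ b ] ⟩
    [ a ≡ b ]                                ∎
    where
    collapse : ∀ z → [ z ≡ a ] * [ z ≡ b ] ≡ [ z ≡ a ] * [ a ≡ b ]
    collapse z with p ℕ.∣? ∣ z - a ∣
    ... | yes p∣z-a = cong (1ℤ *_) ([≡]-transport z a b (∣ᵤ⇒∣ p∣z-a))
    ... | no _      = refl

module AffinePlane (p : ℕ) (p-prime : Prime p) where

  open Matrices
  open ParallelClassCore using (ParallelClasses)
  open Residues p p-prime
  open import Data.Integer using (ℤ; +_; _+_; _-_; _*_; 0ℤ; 1ℤ)
  open import Data.Integer.Properties using (+-*-semiring; *-identityˡ; *-identityʳ)
  open import Data.Integer.Divisibility.Signed using (_∣_; _∣?_; divides)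
  open import Data.Integer.Tactic.RingSolver using (solve-∀)
  open import Algebra.Properties.Semiring.Sum +-*-semiring

  Point : Set
  Point = Fin p × Fin p

  line : Fin (suc p) → Point → Point → ℤ
  line zero    (u₁ , _)  (v₁ , _)  = [ ι v₁ ≡ ι u₁ ]
  line (suc s) (u₁ , u₂) (v₁ , v₂) = [ ι v₂ ≡ ι u₂ + ι s * (ι v₁ - ι u₁) ]

  line-refl : ∀ L u → line L u u ≡ 1ℤ
  line-refl zero    (u₁ , u₂) = [≡]-refl (ι u₁)
  line-refl (suc s) (u₁ , u₂) = [p∣]-true (divides 0ℤ (vanish (ι u₂) (ι s) (ι u₁)))
    where
    vanish : ∀ a s b → a - (a + s * (b - b)) ≡ 0ℤ
    vanish = solve-∀

  line-sym : ∀ L u v → line L u v ≡ line L v u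
  line-sym zero    (u₁ , u₂) (v₁ , v₂) = [≡]-sym (ι v₁) (ι u₁)
  line-sym (suc s) (u₁ , u₂) (v₁ , v₂) =
    trans ([≡]-sym (ι v₂) (ι u₂ + ι s * (ι v₁ - ι u₁))) (cong [p∣_] (swap (ι u₁) (ι u₂) (ι v₁) (ι v₂) (ι s)))
    where
    swap : ∀ u₁ u₂ v₁ v₂ s → u₂ + s * (v₁ - u₁) - v₂ ≡ u₂ - (v₂ + s * (u₁ - v₁))
    swap = solve-∀

  line-size : ∀ L u → ∑[ w₁ < p ] ∑[ w₂ < p ] line L u (w₁ , w₂) ≡ + p
  line-size zero (u₁ , u₂) = begin
    ∑[ w₁ < p ] ∑[ w₂ < p ] [ ι w₁ ≡ ι u₁ ]   ≡⟨ sum-cong-≗ (λ w₁ → ∑-const p [ ι w₁ ≡ ι u₁ ]) ⟩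
    ∑[ w₁ < p ] (+ p * [ ι w₁ ≡ ι u₁ ])       ≡⟨ *-distribˡ-sum (+ p) (λ w₁ → [ ι w₁ ≡ ι u₁ ]) ⟨
    + p * ∑[ w₁ < p ] [ ι w₁ ≡ ι u₁ ]         ≡⟨ cong (+ p *_) (count-residues (ι u₁)) ⟩
    + p * 1ℤ                                  ≡⟨ *-identityʳ (+ p) ⟩
    + p                                       ∎
  line-size (suc s) (u₁ , u₂) = begin
    ∑[ w₁ < p ] ∑[ w₂ < p ] [ ι w₂ ≡ ι u₂ + ι s * (ι w₁ - ι u₁) ]
      ≡⟨ sum-cong-≗ (λ w₁ → count-residues (ι u₂ + ι s * (ι w₁ - ι u₁))) ⟩
    ∑[ w₁ < p ] 1ℤ
      ≡⟨ trans (∑-const p 1ℤ) (*-identityʳ (+ p)) ⟩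
    + p ∎

  lines-meet-parallel : ∀ L u v → ∑[ w₁ < p ] ∑[ w₂ < p ] (line L u (w₁ , w₂) * line L v (w₁ , w₂)) ≡ + p * line L u v
  lines-meet-parallel zero (u₁ , u₂) (v₁ , v₂) = begin
    ∑[ w₁ < p ] ∑[ w₂ < p ] ([ ι w₁ ≡ ι u₁ ] * [ ι w₁ ≡ ι v₁ ])
      ≡⟨ sum-cong-≗ (λ w₁ → ∑-const p ([ ι w₁ ≡ ι u₁ ] * [ ι w₁ ≡ ι v₁ ])) ⟩
    ∑[ w₁ < p ] (+ p * ([ ι w₁ ≡ ι u₁ ] * [ ι w₁ ≡ ι v₁ ]))
      ≡⟨ *-distribˡ-sum (+ p) (λ w₁ → [ ι w₁ ≡ ι u₁ ] * [ ι w₁ ≡ ι v₁ ]) ⟨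
    + p * ∑[ w₁ < p ] ([ ι w₁ ≡ ι u₁ ] * [ ι w₁ ≡ ι v₁ ])
      ≡⟨ cong (+ p *_) (trans (count-common (ι u₁) (ι v₁)) ([≡]-sym (ι u₁) (ι v₁))) ⟩
    + p * [ ι v₁ ≡ ι u₁ ] ∎
  lines-meet-parallel (suc s) (u₁ , u₂) (v₁ , v₂) = begin
    ∑[ w₁ < p ] ∑[ w₂ < p ] ([ ι w₂ ≡ α w₁ ] * [ ι w₂ ≡ β w₁ ])
      ≡⟨ sum-cong-≗ (λ w₁ → count-common (α w₁) (β w₁)) ⟩
    ∑[ w₁ < p ] [ α w₁ ≡ β w₁ ]
      ≡⟨ sum-cong-≗ (λ w₁ → trans ([≡]-sym (α w₁) (β w₁))
                                   (cong [p∣_] (cancel (ι u₁) (ι u₂) (ι v₁) (ι v₂) (ι s) (ι w₁)))) ⟩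
    ∑[ w₁ < p ] line (suc s) (u₁ , u₂) (v₁ , v₂)
      ≡⟨ ∑-const p _ ⟩
    + p * line (suc s) (u₁ , u₂) (v₁ , v₂) ∎
    where
    α β : Fin p → ℤ
    α w₁ = ι u₂ + ι s * (ι w₁ - ι u₁)
    β w₁ = ι v₂ + ι s * (ι w₁ - ι v₁)
    cancel : ∀ u₁ u₂ v₁ v₂ s w₁ → v₂ + s * (w₁ - v₁) - (u₂ + s * (w₁ - u₁)) ≡ v₂ - (u₂ + s * (v₁ - u₁))
    cancel = solve-∀

  lines-meet-crossing : ∀ L M → L ≢ M → ∀ u v →
                        ∑[ w₁ < p ] ∑[ w₂ < p ] (line L u (w₁ , w₂) * line M v (w₁ , w₂)) ≡ 1ℤ
  lines-meet-crossing zero zero 0≢0 _ _ = contradiction refl 0≢0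
  lines-meet-crossing zero (suc t) _ (u₁ , u₂) (v₁ , v₂) = begin
    ∑[ w₁ < p ] ∑[ w₂ < p ] ([ ι w₁ ≡ ι u₁ ] * [ ι w₂ ≡ β w₁ ])
      ≡⟨ sum-cong-≗ (λ w₁ → *-distribˡ-sum [ ι w₁ ≡ ι u₁ ] (λ w₂ → [ ι w₂ ≡ β w₁ ])) ⟨
    ∑[ w₁ < p ] ([ ι w₁ ≡ ι u₁ ] * ∑[ w₂ < p ] [ ι w₂ ≡ β w₁ ])
      ≡⟨ sum-cong-≗ (λ w₁ → trans (cong ([ ι w₁ ≡ ι u₁ ] *_) (count-residues (β w₁))) (*-identityʳ _)) ⟩
    ∑[ w₁ < p ] [ ι w₁ ≡ ι u₁ ]
      ≡⟨ count-residues (ι u₁) ⟩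
    1ℤ ∎
    where
    β : Fin p → ℤ
    β w₁ = ι v₂ + ι t * (ι w₁ - ι v₁)
  lines-meet-crossing (suc s) zero _ (u₁ , u₂) (v₁ , v₂) = begin
    ∑[ w₁ < p ] ∑[ w₂ < p ] ([ ι w₂ ≡ α w₁ ] * [ ι w₁ ≡ ι v₁ ])
      ≡⟨ sum-cong-≗ (λ w₁ → *-distribʳ-sum [ ι w₁ ≡ ι v₁ ] (λ w₂ → [ ι w₂ ≡ α w₁ ])) ⟨
    ∑[ w₁ < p ] (∑[ w₂ < p ] [ ι w₂ ≡ α w₁ ] * [ ι w₁ ≡ ι v₁ ])
      ≡⟨ sum-cong-≗ (λ w₁ → trans (cong (_* [ ι w₁ ≡ ι v₁ ]) (count-residues (α w₁))) (*-identityˡ _)) ⟩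
    ∑[ w₁ < p ] [ ι w₁ ≡ ι v₁ ]
      ≡⟨ count-residues (ι v₁) ⟩
    1ℤ ∎
    where
    α : Fin p → ℤ
    α w₁ = ι u₂ + ι s * (ι w₁ - ι u₁)
  lines-meet-crossing (suc s) (suc t) s≢t (u₁ , u₂) (v₁ , v₂) = begin
    ∑[ w₁ < p ] ∑[ w₂ < p ] ([ ι w₂ ≡ α w₁ ] * [ ι w₂ ≡ β w₁ ])
      ≡⟨ sum-cong-≗ (λ w₁ → count-common (α w₁) (β w₁)) ⟩
    ∑[ w₁ < p ] [ α w₁ ≡ β w₁ ]
      ≡⟨ sum-cong-≗ (λ w₁ → cong [p∣_] (separate (ι u₁) (ι u₂) (ι v₁) (ι v₂) (ι s) (ι t) (ι w₁))) ⟩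
    ∑[ w₁ < p ] [ (ι s - ι t) * ι w₁ ≡ ι v₂ - ι u₂ + ι s * ι u₁ - ι t * ι v₁ ]
      ≡⟨ count-solutions (ι s - ι t) _ (s≢t ∘ cong suc ∘ ι-injective) ⟩
    1ℤ ∎
    where
    α β : Fin p → ℤ
    α w₁ = ι u₂ + ι s * (ι w₁ - ι u₁)
    β w₁ = ι v₂ + ι t * (ι w₁ - ι v₁)
    separate : ∀ u₁ u₂ v₁ v₂ s t w₁ → u₂ + s * (w₁ - u₁) - (v₂ + t * (w₁ - v₁))
                                      ≡ (s - t) * w₁ - (v₂ - u₂ + s * u₁ - t * v₁)
    separate = solve-∀

  unique-class : ∀ u v → u ≢ v → ∃ λ L → ∀ M → line M u v ≡ δ L M
  unique-class (u₁ , u₂) (v₁ , v₂) u≢v with + p ∣? ι v₁ - ι u₁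
  ... | yes p∣v₁-u₁ with ι-injective {v₁} {u₁} p∣v₁-u₁
  ...   | refl = zero , vertical
    where
    vanish : ∀ a b s c → a - (b + s * (c - c)) ≡ a - b
    vanish = solve-∀
    vertical : ∀ M → line M (u₁ , u₂) (u₁ , v₂) ≡ δ zero M
    vertical zero    = [≡]-refl (ι u₁)
    vertical (suc s) = [p∣]-false λ p∣Δ →
      u≢v (cong (u₁ ,_) (sym (ι-injective (subst (+ p ∣_) (vanish (ι v₂) (ι u₂) (ι s) (ι u₁)) p∣Δ))))
  unique-class (u₁ , u₂) (v₁ , v₂) u≢v | no p∤v₁-u₁ with solution (ι v₁ - ι u₁) (ι v₂ - ι u₂) p∤v₁-u₁
  ... | s₀ , p∣slope = suc s₀ , sloped
    where
    rearrange : ∀ u₁ u₂ v₁ v₂ s → u₂ + s * (v₁ - u₁) - v₂ ≡ (v₁ - u₁) * s - (v₂ - u₂)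
    rearrange = solve-∀
    sloped : ∀ M → line M (u₁ , u₂) (v₁ , v₂) ≡ δ (suc s₀) M
    sloped zero    = [p∣]-false p∤v₁-u₁
    sloped (suc s) = begin
      [ ι v₂ ≡ ι u₂ + ι s * (ι v₁ - ι u₁) ]   ≡⟨ [≡]-sym (ι v₂) (ι u₂ + ι s * (ι v₁ - ι u₁)) ⟩
      [ ι u₂ + ι s * (ι v₁ - ι u₁) ≡ ι v₂ ]   ≡⟨ cong [p∣_] (rearrange (ι u₁) (ι u₂) (ι v₁) (ι v₂) (ι s)) ⟩
      [ (ι v₁ - ι u₁) * ι s ≡ ι v₂ - ι u₂ ]   ≡⟨ solution-unique p∤v₁-u₁ p∣slope s ⟩
      δ s₀ s                                  ∎

  classes : ParallelClasses p (λ L → flatten (line L))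
  classes = record
    { reflexive     = λ L u → line-refl L (⟨ u ⟩)
    ; symmetric     = λ L u v → line-sym L ⟨ u ⟩ ⟨ v ⟩
    ; line-size     = λ L u → trans (∑-remQuot p (line L ⟨ u ⟩)) (line-size L ⟨ u ⟩)
    ; gram-parallel = λ L u v → trans (∑-remQuot p (λ w → line L ⟨ u ⟩ w * line L ⟨ v ⟩ w))
                                      (lines-meet-parallel L ⟨ u ⟩ ⟨ v ⟩)
    ; gram-crossing = λ L M L≢M u v → trans (∑-remQuot p (λ w → line L ⟨ u ⟩ w * line M ⟨ v ⟩ w))
                                            (lines-meet-crossing L M L≢M ⟨ u ⟩ ⟨ v ⟩)
    ; unique-class  = λ u v u≢v → unique-class ⟨ u ⟩ ⟨ v ⟩ (u≢v ∘ ⟨⟩-injective)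
    }
    where
    ⟨_⟩ : Fin (p ℕ.* p) → Point
    ⟨ u ⟩ = remQuot {p} p u
    ⟨⟩-injective : ∀ {u v} → ⟨ u ⟩ ≡ ⟨ v ⟩ → u ≡ v
    ⟨⟩-injective {u} {v} eq =
      trans (sym (combine-remQuot {p} p u)) (trans (cong (λ (i , a) → combine i a) eq) (combine-remQuot {p} p v))

module Designs where

  open Matrices
  open Conference
  open import Data.Integer using (ℤ; +_; -_; _+_; _-_; _*_; 0ℤ; 1ℤ; -1ℤ; _◃_; sign)
  open import Data.Integer.Properties
    using (+-*-semiring; +-identityˡ; +-identityʳ; *-identityˡ; *-identityʳ; *-zeroˡ; *-zeroʳ; +-comm; *-assoc;
           *-distribʳ-+; pos-*)
  open import Data.Integer.Tactic.RingSolver using (solve-∀)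
  open import Algebra.Properties.Semiring.Sum +-*-semiring
  open import Data.Sign as Sign using (Sign)
  open import Data.Sum using (_⊎_; inj₁; inj₂)
  open import Data.Fin.Patterns using (0F; 1F)

  -- (s , 0) stands for s·i·x₀ and (s , 1) for s·x₁: x₀ only ever carries the units ±i.
  SignedVar : Set
  SignedVar = Sign × Fin 2

  Design : ℕ → Set
  Design n = Fin n → Fin n → SignedVar

  coeff : SignedVar → Fin 2 → ℤ
  coeff (s , zero)  zero    = s ◃ 1
  coeff (s , zero)  (suc _) = 0ℤ
  coeff (s , suc _) zero    = 0ℤ
  coeff (s , suc _) (suc _) = s ◃ 1

  parts : ∀ {n} → Design n → Fin 2 → Mat n
  parts D ℓ i j = coeff (D i j) ℓ

  data Monomial : Set where
    x₀² x₁² x₀x₁ : Monomial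

  -- For D = i x₀ X₀ + x₁ X₁ and E = i x₀ Y₀ + x₁ Y₁, herm X Y c is the coefficient of c in D E*,
  -- except that the x₀x₁ coefficient of D E* is i · herm X Y x₀x₁.
  herm : ∀ {n} → (Fin 2 → Mat n) → (Fin 2 → Mat n) → Monomial → Mat n
  herm X Y x₀²  i j = gram (X 0F) (Y 0F) i j
  herm X Y x₁²  i j = gram (X 1F) (Y 1F) i j
  herm X Y x₀x₁ i j = gram (X 0F) (Y 1F) i j - gram (X 1F) (Y 0F) i j

  ⟪_,_⟫ : ∀ {n} → Design n → Design n → Monomial → Mat n
  ⟪ D , E ⟫ = herm (parts D) (parts E)

  diagForm : ℕ → ℕ → Monomial → ℤ
  diagForm s₁ s₂ x₀²  = + s₁
  diagForm s₁ s₂ x₁²  = + s₂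
  diagForm s₁ s₂ x₀x₁ = 0ℤ

  herm-cong : ∀ {n} {X X′ Y Y′ : Fin 2 → Mat n} →
              (∀ ℓ i j → X ℓ i j ≡ X′ ℓ i j) → (∀ ℓ i j → Y ℓ i j ≡ Y′ ℓ i j) →
              ∀ c i j → herm X Y c i j ≡ herm X′ Y′ c i j
  herm-cong X≗X′ Y≗Y′ x₀²  i j = gram-cong (X≗X′ 0F) (Y≗Y′ 0F) i j
  herm-cong X≗X′ Y≗Y′ x₁²  i j = gram-cong (X≗X′ 1F) (Y≗Y′ 1F) i j
  herm-cong X≗X′ Y≗Y′ x₀x₁ i j =
    cong₂ _-_ (gram-cong (X≗X′ 0F) (Y≗Y′ 1F) i j) (gram-cong (X≗X′ 1F) (Y≗Y′ 0F) i j)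

  private
    interchange : ∀ a b c d → a + b - (c + d) ≡ a - c + (b - d)
    interchange = solve-∀

    factor : ∀ g a b → g * a - g * b ≡ g * (a - b)
    factor = solve-∀

  herm-⊕ˡ : ∀ {n} (X X′ Y : Fin 2 → Mat n) c i j →
            herm (λ ℓ → X ℓ ⊕ X′ ℓ) Y c i j ≡ herm X Y c i j + herm X′ Y c i j
  herm-⊕ˡ X X′ Y x₀²  i j = gram-⊕ˡ (X 0F) (X′ 0F) (Y 0F) i j
  herm-⊕ˡ X X′ Y x₁²  i j = gram-⊕ˡ (X 1F) (X′ 1F) (Y 1F) i j
  herm-⊕ˡ X X′ Y x₀x₁ i j =
    trans (cong₂ _-_ (gram-⊕ˡ (X 0F) (X′ 0F) (Y 1F) i j) (gram-⊕ˡ (X 1F) (X′ 1F) (Y 0F) i j))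
          (interchange (gram (X 0F) (Y 1F) i j) (gram (X′ 0F) (Y 1F) i j)
                       (gram (X 1F) (Y 0F) i j) (gram (X′ 1F) (Y 0F) i j))

  herm-⊕ʳ : ∀ {n} (X Y Y′ : Fin 2 → Mat n) c i j →
            herm X (λ ℓ → Y ℓ ⊕ Y′ ℓ) c i j ≡ herm X Y c i j + herm X Y′ c i j
  herm-⊕ʳ X Y Y′ x₀²  i j = gram-⊕ʳ (X 0F) (Y 0F) (Y′ 0F) i j
  herm-⊕ʳ X Y Y′ x₁²  i j = gram-⊕ʳ (X 1F) (Y 1F) (Y′ 1F) i j
  herm-⊕ʳ X Y Y′ x₀x₁ i j =
    trans (cong₂ _-_ (gram-⊕ʳ (X 0F) (Y 1F) (Y′ 1F) i j) (gram-⊕ʳ (X 1F) (Y 0F) (Y′ 0F) i j))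
          (interchange (gram (X 0F) (Y 1F) i j) (gram (X 0F) (Y′ 1F) i j)
                       (gram (X 1F) (Y 0F) i j) (gram (X 1F) (Y′ 0F) i j))

  herm-⊗ : ∀ {n m} (P P′ : Mat n) (X Y : Fin 2 → Mat m) c i a j b →
           herm (λ ℓ → P ⊗ X ℓ) (λ ℓ → P′ ⊗ Y ℓ) c (combine i a) (combine j b) ≡ gram P P′ i j * herm X Y c a b
  herm-⊗ P P′ X Y x₀²  i a j b = gram-⊗ P P′ (X 0F) (Y 0F) i a j b
  herm-⊗ P P′ X Y x₁²  i a j b = gram-⊗ P P′ (X 1F) (Y 1F) i a j b
  herm-⊗ P P′ X Y x₀x₁ i a j b =
    trans (cong₂ _-_ (gram-⊗ P P′ (X 0F) (Y 1F) i a j b) (gram-⊗ P P′ (X 1F) (Y 0F) i a j b))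
          (factor (gram P P′ i j) (gram (X 0F) (Y 1F) a b) (gram (X 1F) (Y 0F) a b))

  _·_ : Sign → SignedVar → SignedVar
  s · (t , v) = (s Sign.* t , v)

  coeff-· : ∀ s e ℓ → coeff (s · e) ℓ ≡ (s ◃ 1) * coeff e ℓ
  coeff-· s (t , 0F)    0F      = sign-product s t
    where
    sign-product : ∀ s t → (s Sign.* t) ◃ 1 ≡ (s ◃ 1) * (t ◃ 1)
    sign-product Sign.- Sign.- = refl
    sign-product Sign.- Sign.+ = refl
    sign-product Sign.+ Sign.- = refl
    sign-product Sign.+ Sign.+ = refl
  coeff-· s (t , 0F)    (suc _) = sym (*-zeroʳ (s ◃ 1))
  coeff-· s (t , suc _) 0F      = sym (*-zeroʳ (s ◃ 1))
  coeff-· s (t , suc _) (suc _) = coeff-· s (t , 0F) 0F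

  blockEntry : ∀ {n m} → Mat n → Design m → Design m → Fin n × Fin m → Fin n × Fin m → SignedVar
  blockEntry P M L (i , a) (j , b) with i ≟ j
  ... | yes _ = L a b
  ... | no _  = sign (P i j) · M a b

  blockKron : ∀ {n m} → Mat n → Design m → Design m → Design (n ℕ.* m)
  blockKron P M L = flatten (blockEntry P M L)

  inflate : ∀ {n m} → Design m → Design (n ℕ.* m)
  inflate {n} {m} M = flatten {n} {m} (λ (_ , a) (_ , b) → M a b)

  parts-blockKron : ∀ {n m} {P : Mat n} (M L : Design m) → IsSeidel P →
                    ∀ ℓ i′ j′ → parts (blockKron P M L) ℓ i′ j′ ≡ (P ⊗ parts M ℓ ⊕ I {n} ⊗ parts L ℓ) i′ j′
  parts-blockKron {n} {m} {P} M L seidel ℓ i′ j′ = entry (remQuot {n} m i′) (remQuot {n} m j′)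
    where
    open IsSeidel seidel
    sign-◃ : ∀ {z} → z ≡ 1ℤ ⊎ z ≡ -1ℤ → sign z ◃ 1 ≡ z
    sign-◃ (inj₁ refl) = refl
    sign-◃ (inj₂ refl) = refl
    entry : ∀ ((i , a) (j , b) : Fin n × Fin m) →
            coeff (blockEntry P M L (i , a) (j , b)) ℓ ≡ P i j * coeff (M a b) ℓ + δ i j * coeff (L a b) ℓ
    entry (i , a) (j , b) with i ≟ j
    ... | yes refl = begin
      coeff (L a b) ℓ                              ≡⟨ *-identityˡ _ ⟨
      1ℤ * coeff (L a b) ℓ                         ≡⟨ +-identityˡ _ ⟨
      0ℤ + 1ℤ * coeff (L a b) ℓ                    ≡⟨ cong (_+ 1ℤ * coeff (L a b) ℓ) (*-zeroˡ (coeff (M a b) ℓ)) ⟨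
      0ℤ * coeff (M a b) ℓ + 1ℤ * coeff (L a b) ℓ  ≡⟨ cong (λ z → z * coeff (M a b) ℓ + 1ℤ * coeff (L a b) ℓ) (hollow i) ⟨
      P i i * coeff (M a b) ℓ + 1ℤ * coeff (L a b) ℓ ∎
    ... | no i≢j = begin
      coeff (sign (P i j) · M a b) ℓ               ≡⟨ coeff-· (sign (P i j)) (M a b) ℓ ⟩
      (sign (P i j) ◃ 1) * coeff (M a b) ℓ         ≡⟨ cong (_* coeff (M a b) ℓ) (sign-◃ (signed i j i≢j)) ⟩
      P i j * coeff (M a b) ℓ                      ≡⟨ +-identityʳ _ ⟨
      P i j * coeff (M a b) ℓ + 0ℤ                 ∎

  parts-inflate : ∀ {n m} (M : Design m) ℓ i′ j′ → parts (inflate {n} M) ℓ i′ j′ ≡ (J {n} ⊗ parts M ℓ) i′ j′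
  parts-inflate M ℓ i′ j′ = sym (*-identityˡ _)

  herm-inflate : ∀ {n m} (M N : Design m) c (i : Fin n) a (j : Fin n) b →
                 ⟪ inflate {n} M , inflate {n} N ⟫ c (combine i a) (combine j b) ≡ + n * ⟪ M , N ⟫ c a b
  herm-inflate {n} M N c i a j b = begin
    ⟪ inflate {n} M , inflate {n} N ⟫ c (combine i a) (combine j b)
      ≡⟨ herm-cong (parts-inflate {n} M) (parts-inflate {n} N) c (combine i a) (combine j b) ⟩
    herm (λ ℓ → J {n} ⊗ parts M ℓ) (λ ℓ → J {n} ⊗ parts N ℓ) c (combine i a) (combine j b)
      ≡⟨ herm-⊗ (J {n}) J (parts M) (parts N) c i a j b ⟩
    gram J J i j * ⟪ M , N ⟫ c a b
      ≡⟨ cong (_* ⟪ M , N ⟫ c a b) (gram-JJ i j) ⟩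
    + n * ⟪ M , N ⟫ c a b ∎

  module _ {n m} {P : Mat n} (seidel : IsSeidel P) (M L : Design m) where

    open IsSeidel seidel

    private
      PM IL B : Fin 2 → Mat (n ℕ.* m)
      PM ℓ = P ⊗ parts M ℓ
      IL ℓ = I {n} ⊗ parts L ℓ
      B ℓ = PM ℓ ⊕ IL ℓ

    herm-blockKron : ∀ c (i : Fin n) a (j : Fin n) b →
      ⟪ blockKron P M L , blockKron P M L ⟫ c (combine i a) (combine j b)
        ≡ gram P P i j * ⟪ M , M ⟫ c a b + P i j * (⟪ M , L ⟫ c a b + ⟪ L , M ⟫ c a b) + δ i j * ⟪ L , L ⟫ c a b
    herm-blockKron c i a j b = begin
      ⟪ blockKron P M L , blockKron P M L ⟫ c i′ j′
        ≡⟨ herm-cong (parts-blockKron M L seidel) (parts-blockKron M L seidel) c i′ j′ ⟩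
      herm B B c i′ j′
        ≡⟨ herm-⊕ˡ PM IL B c i′ j′ ⟩
      herm PM B c i′ j′ + herm IL B c i′ j′
        ≡⟨ cong₂ _+_ (herm-⊕ʳ PM PM IL c i′ j′) (herm-⊕ʳ IL PM IL c i′ j′) ⟩
      (herm PM PM c i′ j′ + herm PM IL c i′ j′) + (herm IL PM c i′ j′ + herm IL IL c i′ j′)
        ≡⟨ cong₂ _+_ (cong₂ _+_ (herm-⊗ P P (parts M) (parts M) c i a j b) (herm-⊗ P I (parts M) (parts L) c i a j b))
                     (cong₂ _+_ (herm-⊗ I P (parts L) (parts M) c i a j b) (herm-⊗ I I (parts L) (parts L) c i a j b)) ⟩
      (gram P P i j * MM + gram P I i j * ML) + (gram I P i j * LM + gram I I i j * LL)
        ≡⟨ cong₃ (λ x y z → (gram P P i j * MM + x * ML) + (y * LM + z * LL))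
                 (gram-Iʳ P i j) (trans (gram-Iˡ P i j) (symmetric j i)) (gram-Iʳ I i j) ⟩
      (gram P P i j * MM + P i j * ML) + (P i j * LM + δ i j * LL)
        ≡⟨ regroup (gram P P i j) (P i j) (δ i j) MM ML LM LL ⟩
      gram P P i j * MM + P i j * (ML + LM) + δ i j * LL ∎
      where
      i′ = combine i a
      j′ = combine j b
      MM = ⟪ M , M ⟫ c a b
      ML = ⟪ M , L ⟫ c a b
      LM = ⟪ L , M ⟫ c a b
      LL = ⟪ L , L ⟫ c a b
      cong₃ : ∀ (f : ℤ → ℤ → ℤ → ℤ) {x x′ y y′ z z′} → x ≡ x′ → y ≡ y′ → z ≡ z′ → f x y z ≡ f x′ y′ z′
      cong₃ f refl refl refl = refl
      regroup : ∀ g p d mm ml lm ll → (g * mm + p * ml) + (p * lm + d * ll) ≡ g * mm + p * (ml + lm) + d * ll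
      regroup = solve-∀

    module _ (row-sum : ∀ i → ∑[ j < n ] P i j ≡ 0ℤ) (N : Design m) where

      herm-blockKron-inflate : ∀ c (i : Fin n) a (j : Fin n) b →
        ⟪ blockKron P M L , inflate {n} N ⟫ c (combine i a) (combine j b) ≡ ⟪ L , N ⟫ c a b
      herm-blockKron-inflate c i a j b = begin
        ⟪ blockKron P M L , inflate {n} N ⟫ c i′ j′
          ≡⟨ herm-cong (parts-blockKron M L seidel) (parts-inflate {n} N) c i′ j′ ⟩
        herm B JN c i′ j′
          ≡⟨ herm-⊕ˡ PM IL JN c i′ j′ ⟩
        herm PM JN c i′ j′ + herm IL JN c i′ j′
          ≡⟨ cong₂ _+_ (herm-⊗ P J (parts M) (parts N) c i a j b) (herm-⊗ I J (parts L) (parts N) c i a j b) ⟩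
        gram P J i j * ⟪ M , N ⟫ c a b + gram I J i j * ⟪ L , N ⟫ c a b
          ≡⟨ cong (λ x → x * ⟪ M , N ⟫ c a b + gram I J i j * ⟪ L , N ⟫ c a b) (trans (gram-Jʳ P i j) (row-sum i)) ⟩
        0ℤ * ⟪ M , N ⟫ c a b + gram I J i j * ⟪ L , N ⟫ c a b
          ≡⟨ cong (λ x → 0ℤ * ⟪ M , N ⟫ c a b + x * ⟪ L , N ⟫ c a b) (gram-Iˡ J i j) ⟩
        0ℤ * ⟪ M , N ⟫ c a b + 1ℤ * ⟪ L , N ⟫ c a b
          ≡⟨ cong (_+_ (0ℤ * ⟪ M , N ⟫ c a b)) (*-identityˡ (⟪ L , N ⟫ c a b)) ⟩
        0ℤ * ⟪ M , N ⟫ c a b + ⟪ L , N ⟫ c a b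
          ≡⟨ trans (cong (_+ ⟪ L , N ⟫ c a b) (*-zeroˡ (⟪ M , N ⟫ c a b))) (+-identityˡ (⟪ L , N ⟫ c a b)) ⟩
        ⟪ L , N ⟫ c a b ∎
        where
        i′ = combine i a
        j′ = combine j b
        JN : Fin 2 → Mat (n ℕ.* m)
        JN ℓ = J {n} ⊗ parts N ℓ

      herm-inflate-blockKron : ∀ c (i : Fin n) a (j : Fin n) b →
        ⟪ inflate {n} N , blockKron P M L ⟫ c (combine i a) (combine j b) ≡ ⟪ N , L ⟫ c a b
      herm-inflate-blockKron c i a j b = begin
        ⟪ inflate {n} N , blockKron P M L ⟫ c i′ j′
          ≡⟨ herm-cong (parts-inflate {n} N) (parts-blockKron M L seidel) c i′ j′ ⟩
        herm JN B c i′ j′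
          ≡⟨ herm-⊕ʳ JN PM IL c i′ j′ ⟩
        herm JN PM c i′ j′ + herm JN IL c i′ j′
          ≡⟨ cong₂ _+_ (herm-⊗ J P (parts N) (parts M) c i a j b) (herm-⊗ J I (parts N) (parts L) c i a j b) ⟩
        gram J P i j * ⟪ N , M ⟫ c a b + gram J I i j * ⟪ N , L ⟫ c a b
          ≡⟨ cong (λ x → x * ⟪ N , M ⟫ c a b + gram J I i j * ⟪ N , L ⟫ c a b) (trans (gram-Jˡ P i j) (row-sum j)) ⟩
        0ℤ * ⟪ N , M ⟫ c a b + gram J I i j * ⟪ N , L ⟫ c a b
          ≡⟨ cong (λ x → 0ℤ * ⟪ N , M ⟫ c a b + x * ⟪ N , L ⟫ c a b) (gram-Iʳ J i j) ⟩
        0ℤ * ⟪ N , M ⟫ c a b + 1ℤ * ⟪ N , L ⟫ c a b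
          ≡⟨ cong (_+_ (0ℤ * ⟪ N , M ⟫ c a b)) (*-identityˡ (⟪ N , L ⟫ c a b)) ⟩
        0ℤ * ⟪ N , M ⟫ c a b + ⟪ N , L ⟫ c a b
          ≡⟨ trans (cong (_+ ⟪ N , L ⟫ c a b) (*-zeroˡ (⟪ N , M ⟫ c a b))) (+-identityˡ (⟪ N , L ⟫ c a b)) ⟩
        ⟪ N , L ⟫ c a b ∎
        where
        i′ = combine i a
        j′ = combine j b
        JN : Fin 2 → Mat (n ℕ.* m)
        JN ℓ = J {n} ⊗ parts N ℓ

  toEntry : SignedVar → Entry 2
  toEntry (Sign.+ , 0F)    = varE 0F iu
  toEntry (Sign.- , 0F)    = varE 0F minusI
  toEntry (Sign.+ , suc v) = varE (suc v) one
  toEntry (Sign.- , suc v) = varE (suc v) minusOne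

  toMatrix : ∀ {n} → Design n → Matrix 2 n
  toMatrix D a b = toEntry (D a b)

  infixr 25 _⋆_

  _⋆_ : ℤ → ℤi → ℤi
  z ⋆ (a +i b) = (z * a) +i (z * b)

  unit : Fin 2 → ℤi
  unit 0F      = 0ℤ +i 1ℤ
  unit (suc _) = 1ℤ +i 0ℤ

  coefficient : ∀ {m} → Entry m → Fin m → ℤi
  coefficient zeroE      ℓ = 0ᵢ
  coefficient (varE a u) ℓ = if does (a ≟ ℓ) then unitVal u else 0ᵢ

  *ᵢ-zeroˡ : ∀ z → 0ᵢ *ᵢ z ≡ 0ᵢ
  *ᵢ-zeroˡ (a +i b) = refl

  *ᵢ-zeroʳ : ∀ z → z *ᵢ 0ᵢ ≡ 0ᵢ
  *ᵢ-zeroʳ (a +i b) = cong₂ _+i_ (vanish₁ a b) (vanish₂ a b)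
    where
    vanish₁ : ∀ a b → a * 0ℤ - b * 0ℤ ≡ 0ℤ
    vanish₁ = solve-∀
    vanish₂ : ∀ a b → a * 0ℤ + b * 0ℤ ≡ 0ℤ
    vanish₂ = solve-∀

  prodCoef-coefficient : ∀ {m} (e f : Entry m) ℓ ℓ′ → prodCoef e f ℓ ℓ′ ≡ coefficient e ℓ *ᵢ conjᵢ (coefficient f ℓ′)
  prodCoef-coefficient zeroE      f          ℓ ℓ′ = sym (*ᵢ-zeroˡ (conjᵢ (coefficient f ℓ′)))
  prodCoef-coefficient (varE a u) zeroE      ℓ ℓ′ = sym (*ᵢ-zeroʳ (coefficient (varE a u) ℓ))
  prodCoef-coefficient (varE a u) (varE b v) ℓ ℓ′ with a ≟ ℓ | b ≟ ℓ′
  ... | yes _ | yes _ = refl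
  ... | yes _ | no _  = sym (*ᵢ-zeroʳ (unitVal u))
  ... | no _  | _     = sym (*ᵢ-zeroˡ (conjᵢ (coefficient (varE b v) ℓ′)))

  coefficient-toEntry : ∀ e ℓ → coefficient (toEntry e) ℓ ≡ coeff e ℓ ⋆ unit ℓ
  coefficient-toEntry (Sign.+ , 0F) 0F = refl
  coefficient-toEntry (Sign.- , 0F) 0F = refl
  coefficient-toEntry (Sign.+ , 0F) 1F = refl
  coefficient-toEntry (Sign.- , 0F) 1F = refl
  coefficient-toEntry (Sign.+ , 1F) 0F = refl
  coefficient-toEntry (Sign.- , 1F) 0F = refl
  coefficient-toEntry (Sign.+ , 1F) 1F = refl
  coefficient-toEntry (Sign.- , 1F) 1F = refl

  ⋆-*ᵢ-conj : ∀ a b u v → (a ⋆ u) *ᵢ conjᵢ (b ⋆ v) ≡ (a * b) ⋆ (u *ᵢ conjᵢ v)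
  ⋆-*ᵢ-conj a b (u₁ +i u₂) (v₁ +i v₂) = cong₂ _+i_ (real a b u₁ u₂ v₁ v₂) (imaginary a b u₁ u₂ v₁ v₂)
    where
    real : ∀ a b u₁ u₂ v₁ v₂ → a * u₁ * (b * v₁) - a * u₂ * - (b * v₂) ≡ a * b * (u₁ * v₁ - u₂ * - v₂)
    real = solve-∀
    imaginary : ∀ a b u₁ u₂ v₁ v₂ → a * u₁ * - (b * v₂) + a * u₂ * (b * v₁) ≡ a * b * (u₁ * - v₂ + u₂ * v₁)
    imaginary = solve-∀

  sumFin-⋆ : ∀ n (f : Fin n → ℤ) w → sumFin n (λ c → f c ⋆ w) ≡ (∑[ c < n ] f c) ⋆ w
  sumFin-⋆ zero    f (w₁ +i w₂) = refl
  sumFin-⋆ (suc n) f (w₁ +i w₂) =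
    trans (cong (f 0F ⋆ (w₁ +i w₂) +ᵢ_) (sumFin-⋆ n (λ c → f (suc c)) (w₁ +i w₂)))
          (cong₂ _+i_ (sym (*-distribʳ-+ w₁ (f 0F) _)) (sym (*-distribʳ-+ w₂ (f 0F) _)))

  sumFin-cong : ∀ n {f g : Fin n → ℤi} → (∀ c → f c ≡ g c) → sumFin n f ≡ sumFin n g
  sumFin-cong zero    f≗g = refl
  sumFin-cong (suc n) f≗g = cong₂ _+ᵢ_ (f≗g 0F) (sumFin-cong n (λ c → f≗g (suc c)))

  DDstar-toMatrix : ∀ {n} (D : Design n) a b ℓ ℓ′ →
                    DDstar (toMatrix D) a b ℓ ℓ′ ≡ gram (parts D ℓ) (parts D ℓ′) a b ⋆ (unit ℓ *ᵢ conjᵢ (unit ℓ′))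
  DDstar-toMatrix {n} D a b ℓ ℓ′ =
    trans (sumFin-cong n entry) (sumFin-⋆ n (λ c → coeff (D a c) ℓ * coeff (D b c) ℓ′) (unit ℓ *ᵢ conjᵢ (unit ℓ′)))
    where
    entry : ∀ c → prodCoef (toEntry (D a c)) (toEntry (D b c)) ℓ ℓ′
                  ≡ (coeff (D a c) ℓ * coeff (D b c) ℓ′) ⋆ (unit ℓ *ᵢ conjᵢ (unit ℓ′))
    entry c = begin
      prodCoef (toEntry (D a c)) (toEntry (D b c)) ℓ ℓ′
        ≡⟨ prodCoef-coefficient (toEntry (D a c)) (toEntry (D b c)) ℓ ℓ′ ⟩
      coefficient (toEntry (D a c)) ℓ *ᵢ conjᵢ (coefficient (toEntry (D b c)) ℓ′)
        ≡⟨ cong₂ (λ x y → x *ᵢ conjᵢ y) (coefficient-toEntry (D a c) ℓ) (coefficient-toEntry (D b c) ℓ′) ⟩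
      (coeff (D a c) ℓ ⋆ unit ℓ) *ᵢ conjᵢ (coeff (D b c) ℓ′ ⋆ unit ℓ′)
        ≡⟨ ⋆-*ᵢ-conj (coeff (D a c) ℓ) (coeff (D b c) ℓ′) (unit ℓ) (unit ℓ′) ⟩
      (coeff (D a c) ℓ * coeff (D b c) ℓ′) ⋆ (unit ℓ *ᵢ conjᵢ (unit ℓ′)) ∎

  target-diagonal : ∀ {n} (s : Fin 2 → ℕ) (a b : Fin n) ℓ → target s a b ℓ ℓ ≡ (δ a b * + s ℓ) +i 0ℤ
  target-diagonal s a b ℓ with a ≟ b | ℓ ≟ ℓ
  ... | yes _ | yes _  = cong (_+i 0ℤ) (sym (*-identityˡ (+ s ℓ)))
  ... | no _  | _      = refl
  ... | yes _ | no ℓ≢ℓ = contradiction refl ℓ≢ℓ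

  target-off : ∀ {n} (s : Fin 2 → ℕ) (a b : Fin n) {ℓ ℓ′} → ℓ ≢ ℓ′ → target s a b ℓ ℓ′ ≡ 0ᵢ
  target-off s a b {ℓ} {ℓ′} ℓ≢ℓ′ with a ≟ b | ℓ ≟ ℓ′
  ... | yes _ | yes ℓ≡ℓ′ = contradiction ℓ≡ℓ′ ℓ≢ℓ′
  ... | yes _ | no _     = refl
  ... | no _  | _        = refl

  module _ {n s₁ s₂} (D : Design n) (herm-D : ∀ c a b → ⟪ D , D ⟫ c a b ≡ δ a b * diagForm s₁ s₂ c) where

    private
      ⋆-real : ∀ g → g ⋆ (1ℤ +i 0ℤ) ≡ g +i 0ℤ
      ⋆-real g = cong₂ _+i_ (*-identityʳ g) (*-zeroʳ g)

      ⋆-imaginary : ∀ g h → g ⋆ (0ℤ +i 1ℤ) +ᵢ h ⋆ (0ℤ +i -1ℤ) ≡ 0ℤ +i (g - h)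
      ⋆-imaginary g h = cong₂ _+i_ (vanish g h) (difference g h)
        where
        vanish : ∀ g h → g * 0ℤ + h * 0ℤ ≡ 0ℤ
        vanish = solve-∀
        difference : ∀ g h → g * 1ℤ + h * -1ℤ ≡ g - h
        difference = solve-∀

      ⋆-imaginary′ : ∀ g h → h ⋆ (0ℤ +i -1ℤ) +ᵢ g ⋆ (0ℤ +i 1ℤ) ≡ 0ℤ +i (g - h)
      ⋆-imaginary′ g h = cong₂ _+i_ (vanish g h) (difference g h)
        where
        vanish : ∀ g h → h * 0ℤ + g * 0ℤ ≡ 0ℤ
        vanish = solve-∀
        difference : ∀ g h → h * -1ℤ + g * 1ℤ ≡ g - h
        difference = solve-∀

      diagonal : ∀ a b ℓ c → gram (parts D ℓ) (parts D ℓ) a b ≡ ⟪ D , D ⟫ c a b →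
                 unit ℓ *ᵢ conjᵢ (unit ℓ) ≡ 1ℤ +i 0ℤ → + type2 s₁ s₂ ℓ ≡ diagForm s₁ s₂ c →
                 DDstar (toMatrix D) a b ℓ ℓ ≡ target (type2 s₁ s₂) a b ℓ ℓ
      diagonal a b ℓ c gram≡herm |unit|≡1 s≡form = begin
        DDstar (toMatrix D) a b ℓ ℓ                         ≡⟨ DDstar-toMatrix D a b ℓ ℓ ⟩
        gram (parts D ℓ) (parts D ℓ) a b ⋆ (unit ℓ *ᵢ conjᵢ (unit ℓ))
                                                           ≡⟨ cong₂ _⋆_ gram≡herm |unit|≡1 ⟩
        ⟪ D , D ⟫ c a b ⋆ (1ℤ +i 0ℤ)                       ≡⟨ ⋆-real (⟪ D , D ⟫ c a b) ⟩
        ⟪ D , D ⟫ c a b +i 0ℤ                              ≡⟨ cong (_+i 0ℤ) (trans (herm-D c a b) (cong (δ a b *_) (sym s≡form))) ⟩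
        (δ a b * + type2 s₁ s₂ ℓ) +i 0ℤ                    ≡⟨ target-diagonal (type2 s₁ s₂) a b ℓ ⟨
        target (type2 s₁ s₂) a b ℓ ℓ                        ∎

      antisymmetric : ∀ a b → DDstar (toMatrix D) a b 0F 1F +ᵢ DDstar (toMatrix D) a b 1F 0F ≡ 0ℤ +i ⟪ D , D ⟫ x₀x₁ a b
      antisymmetric a b =
        trans (cong₂ _+ᵢ_ (DDstar-toMatrix D a b 0F 1F) (DDstar-toMatrix D a b 1F 0F))
              (⋆-imaginary (gram (parts D 0F) (parts D 1F) a b) (gram (parts D 1F) (parts D 0F) a b))

      antisymmetric′ : ∀ a b → DDstar (toMatrix D) a b 1F 0F +ᵢ DDstar (toMatrix D) a b 0F 1F ≡ 0ℤ +i ⟪ D , D ⟫ x₀x₁ a b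
      antisymmetric′ a b =
        trans (cong₂ _+ᵢ_ (DDstar-toMatrix D a b 1F 0F) (DDstar-toMatrix D a b 0F 1F))
              (⋆-imaginary′ (gram (parts D 0F) (parts D 1F) a b) (gram (parts D 1F) (parts D 0F) a b))

      x₀x₁-vanishes : ∀ a b → 0ℤ +i ⟪ D , D ⟫ x₀x₁ a b ≡ 0ᵢ
      x₀x₁-vanishes a b = cong (0ℤ +i_) (trans (herm-D x₀x₁ a b) (*-zeroʳ (δ a b)))

    isCOD : IsCOD n (type2 s₁ s₂) (toMatrix D)
    isCOD a b 0F 0F = (λ _ → diagonal a b 0F x₀² refl refl refl) , (λ 0≢0 → contradiction refl 0≢0)
    isCOD a b 1F 1F = (λ _ → diagonal a b 1F x₁² refl refl refl) , (λ 1≢1 → contradiction refl 1≢1)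
    isCOD a b 0F 1F = (λ ()) , λ _ → begin
      DDstar (toMatrix D) a b 0F 1F +ᵢ DDstar (toMatrix D) a b 1F 0F
        ≡⟨ trans (antisymmetric a b) (x₀x₁-vanishes a b) ⟩
      0ᵢ
        ≡⟨ cong₂ _+ᵢ_ (target-off (type2 s₁ s₂) a b (λ ())) (target-off (type2 s₁ s₂) a b (λ ())) ⟨
      target (type2 s₁ s₂) a b 0F 1F +ᵢ target (type2 s₁ s₂) a b 1F 0F ∎
    isCOD a b 1F 0F = (λ ()) , λ _ → begin
      DDstar (toMatrix D) a b 1F 0F +ᵢ DDstar (toMatrix D) a b 0F 1F
        ≡⟨ trans (antisymmetric′ a b) (x₀x₁-vanishes a b) ⟩
      0ᵢ
        ≡⟨ cong₂ _+ᵢ_ (target-off (type2 s₁ s₂) a b (λ ())) (target-off (type2 s₁ s₂) a b (λ ())) ⟨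
      target (type2 s₁ s₂) a b 1F 0F +ᵢ target (type2 s₁ s₂) a b 0F 1F ∎

  record Invariant {m} (q s₁ s₂ : ℕ) (M L : Design m) : Set where
    field
      norm   : ∀ c a b → + q * ⟪ M , M ⟫ c a b + ⟪ L , L ⟫ c a b ≡ δ a b * diagForm s₁ s₂ c
      cancel : ∀ c a b → ⟪ M , L ⟫ c a b + ⟪ L , M ⟫ c a b ≡ 0ℤ

  diagForm-scale : ∀ q s₁ s₂ c → + q * diagForm s₁ s₂ c ≡ diagForm (q ℕ.* s₁) (q ℕ.* s₂) c
  diagForm-scale q s₁ s₂ x₀²  = sym (pos-* q s₁)
  diagForm-scale q s₁ s₂ x₁²  = sym (pos-* q s₂)
  diagForm-scale q s₁ s₂ x₀x₁ = *-zeroʳ (+ q)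

  module _ {q} {C : Mat (suc q)} (conference : IsSymmetricConference q C)
           {m s₁ s₂} {M L : Design m} (inv : Invariant q s₁ s₂ M L) where

    open IsSymmetricConference conference
    open Invariant inv

    conference-design-entry : ∀ c i a j b →
      ⟪ blockKron C M L , blockKron C M L ⟫ c (combine i a) (combine j b)
        ≡ δ (combine i a) (combine j b) * diagForm s₁ s₂ c
    conference-design-entry c i a j b = begin
      ⟪ blockKron C M L , blockKron C M L ⟫ c (combine i a) (combine j b)
        ≡⟨ herm-blockKron seidel M L c i a j b ⟩
      gram C C i j * MM + C i j * (ML + LM) + δ i j * LL
        ≡⟨ cong₂ (λ g x → g * MM + C i j * x + δ i j * LL) (gram-self i j) (cancel c a b) ⟩
      + q * δ i j * MM + C i j * 0ℤ + δ i j * LL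
        ≡⟨ collect (+ q) (δ i j) (C i j) MM LL ⟩
      δ i j * (+ q * MM + LL)
        ≡⟨ cong (δ i j *_) (norm c a b) ⟩
      δ i j * (δ a b * diagForm s₁ s₂ c)
        ≡⟨ *-assoc (δ i j) (δ a b) (diagForm s₁ s₂ c) ⟨
      δ i j * δ a b * diagForm s₁ s₂ c
        ≡⟨ cong (_* diagForm s₁ s₂ c) (δ-combine i j a b) ⟨
      δ (combine i a) (combine j b) * diagForm s₁ s₂ c ∎
      where
      MM = ⟪ M , M ⟫ c a b
      ML = ⟪ M , L ⟫ c a b
      LM = ⟪ L , M ⟫ c a b
      LL = ⟪ L , L ⟫ c a b
      collect : ∀ q d b mm ll → q * d * mm + b * 0ℤ + d * ll ≡ d * (q * mm + ll)
      collect = solve-∀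

    conference-design : ∀ c a′ b′ →
      ⟪ blockKron C M L , blockKron C M L ⟫ c a′ b′ ≡ δ a′ b′ * diagForm s₁ s₂ c
    conference-design c = ∀-combine (conference-design-entry c)

  module FromCore {q} {Q : Mat q} (core : IsCore q Q) where

    open IsCore core

    module _ {m s₁ s₂} {M L : Design m} (inv : Invariant q s₁ s₂ M L) where

      open Invariant inv

      step-norm : ∀ c i a j b →
        + q * ⟪ blockKron Q M L , blockKron Q M L ⟫ c (combine i a) (combine j b)
          + ⟪ inflate {q} M , inflate {q} M ⟫ c (combine i a) (combine j b)
        ≡ δ (combine i a) (combine j b) * diagForm (q ℕ.* s₁) (q ℕ.* s₂) c
      step-norm c i a j b = begin
        + q * ⟪ blockKron Q M L , blockKron Q M L ⟫ c i′ j′ + ⟪ inflate {q} M , inflate {q} M ⟫ c i′ j′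
          ≡⟨ cong₂ (λ x y → + q * x + y) (herm-blockKron seidel M L c i a j b) (herm-inflate M M c i a j b) ⟩
        + q * (gram Q Q i j * MM + Q i j * (ML + LM) + δ i j * LL) + + q * MM
          ≡⟨ cong (λ g → + q * (g * MM + Q i j * (ML + LM) + δ i j * LL) + + q * MM) (gram-self i j) ⟩
        + q * ((+ q * δ i j - 1ℤ) * MM + Q i j * (ML + LM) + δ i j * LL) + + q * MM
          ≡⟨ regroup (+ q) (δ i j) (Q i j) MM (ML + LM) LL ⟩
        + q * δ i j * (+ q * MM + LL) + + q * Q i j * (ML + LM)
          ≡⟨ cong₂ (λ x y → + q * δ i j * x + + q * Q i j * y) (norm c a b) (cancel c a b) ⟩
        + q * δ i j * (δ a b * diagForm s₁ s₂ c) + + q * Q i j * 0ℤ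
          ≡⟨ collect (+ q) (δ i j) (Q i j) (δ a b) (diagForm s₁ s₂ c) ⟩
        δ i j * δ a b * (+ q * diagForm s₁ s₂ c)
          ≡⟨ cong₂ _*_ (δ-combine i j a b) (sym (diagForm-scale q s₁ s₂ c)) ⟨
        δ i′ j′ * diagForm (q ℕ.* s₁) (q ℕ.* s₂) c ∎
        where
        i′ = combine i a
        j′ = combine j b
        MM = ⟪ M , M ⟫ c a b
        ML = ⟪ M , L ⟫ c a b
        LM = ⟪ L , M ⟫ c a b
        LL = ⟪ L , L ⟫ c a b
        regroup : ∀ q d p mm x ll →
                  q * ((q * d - 1ℤ) * mm + p * x + d * ll) + q * mm ≡ q * d * (q * mm + ll) + q * p * x
        regroup = solve-∀
        collect : ∀ q d p e w → q * d * (e * w) + q * p * 0ℤ ≡ d * e * (q * w)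
        collect = solve-∀

      step-cancel : ∀ c i a j b →
        ⟪ blockKron Q M L , inflate {q} M ⟫ c (combine i a) (combine j b)
          + ⟪ inflate {q} M , blockKron Q M L ⟫ c (combine i a) (combine j b) ≡ 0ℤ
      step-cancel c i a j b = begin
        ⟪ blockKron Q M L , inflate {q} M ⟫ c (combine i a) (combine j b)
          + ⟪ inflate {q} M , blockKron Q M L ⟫ c (combine i a) (combine j b)
          ≡⟨ cong₂ _+_ (herm-blockKron-inflate seidel M L row-sum M c i a j b)
                       (herm-inflate-blockKron seidel M L row-sum M c i a j b) ⟩
        ⟪ L , M ⟫ c a b + ⟪ M , L ⟫ c a b   ≡⟨ +-comm (⟪ L , M ⟫ c a b) (⟪ M , L ⟫ c a b) ⟩
        ⟪ M , L ⟫ c a b + ⟪ L , M ⟫ c a b   ≡⟨ cancel c a b ⟩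
        0ℤ ∎

      invariant-step : Invariant q (q ℕ.* s₁) (q ℕ.* s₂) (blockKron Q M L) (inflate {q} M)
      invariant-step = record
        { norm   = λ c → ∀-combine (step-norm c)
        ; cancel = λ c → ∀-combine (step-cancel c)
        }

    designs : ∀ k → Design (q ℕ.^ k) × Design (q ℕ.^ k)
    designs zero    = (λ _ _ → Sign.+ , 1F) , (λ _ _ → Sign.+ , 0F)
    designs (suc k) = let (M , L) = designs k in blockKron Q M L , inflate {q} M

    designs-invariant : ∀ k → Invariant q (q ℕ.^ k) (q ℕ.^ suc k) (proj₁ (designs k)) (proj₂ (designs k))
    designs-invariant zero    = record { norm = norm₀ ; cancel = cancel₀ }
      where
      M₀ L₀ : Design 1
      M₀ = proj₁ (designs 0)
      L₀ = proj₂ (designs 0)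
      norm₀ : ∀ c a b → + q * ⟪ M₀ , M₀ ⟫ c a b + ⟪ L₀ , L₀ ⟫ c a b ≡ δ a b * diagForm 1 (q ℕ.* 1) c
      norm₀ x₀²  0F 0F = cong (_+ 1ℤ) (*-zeroʳ (+ q))
      norm₀ x₁²  0F 0F =
        trans (+-identityʳ (+ q * 1ℤ)) (trans (sym (pos-* q 1)) (sym (*-identityˡ (+ (q ℕ.* 1)))))
      norm₀ x₀x₁ 0F 0F = trans (+-identityʳ (+ q * 0ℤ)) (*-zeroʳ (+ q))
      cancel₀ : ∀ c a b → ⟪ M₀ , L₀ ⟫ c a b + ⟪ L₀ , M₀ ⟫ c a b ≡ 0ℤ
      cancel₀ x₀²  0F 0F = refl
      cancel₀ x₁²  0F 0F = refl
      cancel₀ x₀x₁ 0F 0F = refl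
    designs-invariant (suc k) = invariant-step (designs-invariant k)

    cod : ∀ k → COD (suc q ℕ.* q ℕ.^ k) (type2 (q ℕ.^ k) (q ℕ.^ suc k))
    cod k = toMatrix E , isCOD E (conference-design (border-conference core) (designs-invariant k))
      where
      E = blockKron (border Q) (proj₁ (designs k)) (proj₂ (designs k))

open import Data.Nat using (_*_; _+_; _^_)
open import Data.Nat.Divisibility using (_∣_)
open import Data.Nat.Properties using (*-identityʳ; *-suc; +-comm; ^-*-assoc)

COD-cong : ∀ {n n′ s₁ s₁′ s₂ s₂′} → n ≡ n′ → s₁ ≡ s₁′ → s₂ ≡ s₂′ →
           COD n (type2 s₁ s₂) → COD n′ (type2 s₁′ s₂′)
COD-cong refl refl refl d = d

^-of-square : ∀ p k → (p * p) ^ k ≡ p ^ (2 * k)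
^-of-square p k = trans (cong (λ x → (p * x) ^ k) (sym (*-identityʳ p))) (^-*-assoc p 2 k)

theorem4p4 : (p : ℕ) → Prime p → ¬ (2 ∣ p) → (k : ℕ) →
    COD ((1 + p ^ 2) * p ^ (2 * k))
        (type2 (p ^ (2 * k)) (p ^ (2 * k + 2)))
theorem4p4 p p-prime p-odd k = COD-cong order (^-of-square p k) (trans (^-of-square p (suc k)) exponent) (cod k)
  where
  open ParallelClassCore using (signedSum-core; balanced-of-odd)
  open Designs.FromCore (signedSum-core (AffinePlane.classes p p-prime) (balanced-of-odd p-odd))
  order : suc (p * p) * (p * p) ^ k ≡ (1 + p ^ 2) * p ^ (2 * k)
  order = cong₂ _*_ (cong (λ x → suc (p * x)) (sym (*-identityʳ p))) (^-of-square p k)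
  exponent : p ^ (2 * suc k) ≡ p ^ (2 * k + 2)
  exponent = cong (p ^_) (trans (*-suc 2 k) (+-comm 2 (2 * k)))
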